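{- For every prime $p$, $g_{(3,2,1,3)}(p)=5p^4-4p^3+2p^2$.
   Context: For a prime $p$ and a tuple $\alpha=(\alpha_1,\dots,\alpha_{n-1})$ of positive integers, an irreducible subring matrix with diagonal $\alpha$ is an $n\times n$ upper triangular integer matrix $A$ with $A_{ii}=p^{\alpha_i}$ for $1\le i\le n-1$, $A_{nn}=1$, $A_{in}=1$ for all $i$, and $A_{ij}=p\,a_{ij}$ with integers $0\le a_{ij}\le p^{\alpha_i-1}-1$ for $1\le i<j\le n-1$, such that the $\mathbb{Z}$-span of the columns of $A$ is closed under componentwise multiplication of vectors. $g_\alpha(p)$ denotes the number of irreducible subring matrices with diagonal $\alpha$ (here $n=5$). -}

module Defs where

open import Data.Nat as ℕ using (ℕ; suc; _^_; _∸_)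
open import Data.Integer as ℤ using (ℤ; +_)
open import Data.Fin as Fin using (Fin; zero; suc; inject₁; fromℕ)
open import Data.Vec using (Vec; lookup)
open import Data.List using (List; length)
open import Data.List.Membership.Propositional using (_∈_)
open import Data.List.Relation.Unary.Unique.Propositional using (Unique)
open import Data.Product using (Σ; ∃; _×_)
open import Function.Bundles using (_⇔_)
open import Relation.Binary.PropositionalEquality using (_≡_)

Matrix : ℕ → Set
Matrix n = Vec (Vec ℤ n) n

entry : ∀ {n} → Matrix n → Fin n → Fin n → ℤ
entry A i j = lookup (lookup A i) j

∑ : ∀ {n} → (Fin n → ℤ) → ℤ
∑ {ℕ.zero} f = + 0
∑ {suc n} f = f zero ℤ.+ ∑ (λ i → f (suc i))

colComb : ∀ {n} → Matrix n → (Fin n → ℤ) → Fin n → ℤ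
colComb A x k = ∑ (λ j → entry A k j ℤ.* x j)

ColumnSpanMulClosed : ∀ {n} → Matrix n → Set
ColumnSpanMulClosed {n} A =
  ∀ (x y : Fin n → ℤ) → ∃ λ (z : Fin n → ℤ) →
    ∀ k → colComb A x k ℤ.* colComb A y k ≡ colComb A z k

-- Irreducible subring matrix with diagonal α = (α_1,…,α_m), n = m + 1,
-- for the prime p (indices are 0-based here; fromℕ m is the last index n).
record IsIrredSubringMatrix (p : ℕ) {m : ℕ} (α : Vec ℕ m) (A : Matrix (suc m)) : Set where
  field
    upper    : ∀ (i j : Fin (suc m)) → j Fin.< i → entry A i j ≡ + 0
    diag     : ∀ (i : Fin m) → entry A (inject₁ i) (inject₁ i) ≡ + (p ^ lookup α i)
    lastDiag : entry A (fromℕ m) (fromℕ m) ≡ + 1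
    lastCol  : ∀ (i : Fin (suc m)) → entry A i (fromℕ m) ≡ + 1
    offDiag  : ∀ (i j : Fin m) → i Fin.< j →
               Σ ℕ λ a → (a ℕ.< p ^ (lookup α i ∸ 1)) × (entry A (inject₁ i) (inject₁ j) ≡ + (p ℕ.* a))
    closed   : ColumnSpanMulClosed A

-- "g_α(p) = N": the irreducible subring matrices with diagonal α are exactly
-- the entries of a duplicate-free list of length N.
HasCount : ∀ {n} → (Matrix n → Set) → ℕ → Set
HasCount {n} P N = Σ (List (Matrix n)) λ L →
  Unique L × (∀ A → (A ∈ L) ⇔ P A) × (length L ≡ N)

g≡ : (p : ℕ) {m : ℕ} (α : Vec ℕ m) → ℕ → Set
g≡ p α N = HasCount (IsIrredSubringMatrix p α) N

-- Closure of the column span under products only has to be checked on products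
-- c_j ∘ c_l of columns. Expressing them through the columns works in rows 1 to 4 for
-- free (the matrix is upper triangular and its last column is 1), and in row 0 it
-- leaves residues that must be divisible by p³. This forces a₀₁ = p b and, for the
-- remaining entries b, u, v < p and x, y < p², amounts to the congruences
-- x² − x ≡ b(u² − u), xy ≡ buv and y² ≡ bv² (mod p). They only see x and y mod p, and
-- modulo p they have 5p² − 4p + 2 solutions: p² + 2p with v = 0 and, for each v ≠ 0,
-- 2p with y = 0, p with y = v and one for each other y (b and x are then determined
-- and u must vanish). The p² lifts of (x, y) give 5p⁴ − 4p³ + 2p².

module Submission where

open import Defs
open import Data.Nat.Base using (ℕ; zero; suc)
import Data.Nat.Base as Nat
open import Data.Nat.Primality using (Prime; euclidsLemma; prime⇒nonZero; prime⇒nonTrivial)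
open import Data.Integer.Base using (ℤ)
open import Data.Fin.Base using (Fin; zero; suc; inject₁; fromℕ)
open import Data.Fin.Patterns using (0F; 1F; 2F; 3F; 4F)
open import Data.Vec.Base using (Vec; _∷_; []; lookup)
open import Data.Product.Base using (Σ; ∃-syntax; _×_; _,_; proj₁; proj₂)
open import Data.Sum.Base using (_⊎_; inj₁; inj₂; [_,_]′)
open import Data.Empty using (⊥-elim)
open import Function.Base using (_∘_; id)
open import Function.Bundles using (_⇔_; mk⇔; Equivalence)
open import Relation.Nullary using (¬_; Dec; yes; no; contradiction)
open import Relation.Binary.PropositionalEquality
import Data.Nat.Properties as ℕₚ
import Data.Nat.Divisibility as ℕ∣

module FiniteSums where

  open Nat using (_+_; _*_; _<_; _≤_; z≤n)
  open import Data.Nat using (_≟_; _<?_)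
  open import Data.Nat.Tactic.RingSolver using (solve-∀)
  open import Relation.Unary using (Pred; Decidable)
  open import Data.List.Base using ([]; _∷_; length; filter; map; _++_; downFrom; cartesianProduct)
  open import Data.List.Properties using (filter-++; length-++)

  𝟙 : ∀ {a} {A : Set a} → Dec A → ℕ
  𝟙 (yes _) = 1
  𝟙 (no _)  = 0

  𝟙-cong : ∀ {a b} {A : Set a} {B : Set b} → A ⇔ B → (A? : Dec A) (B? : Dec B) → 𝟙 A? ≡ 𝟙 B?
  𝟙-cong A⇔B (yes _) (yes _) = refl
  𝟙-cong A⇔B (yes a) (no ¬b) = ⊥-elim (¬b (Equivalence.to A⇔B a))
  𝟙-cong A⇔B (no ¬a) (yes b) = ⊥-elim (¬a (Equivalence.from A⇔B b))
  𝟙-cong A⇔B (no _)  (no _)  = refl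

  𝟙-yes : ∀ {a} {A : Set a} → A → (A? : Dec A) → 𝟙 A? ≡ 1
  𝟙-yes a (yes _) = refl
  𝟙-yes a (no ¬a) = ⊥-elim (¬a a)

  𝟙-no : ∀ {a} {A : Set a} → ¬ A → (A? : Dec A) → 𝟙 A? ≡ 0
  𝟙-no ¬a (yes a) = ⊥-elim (¬a a)
  𝟙-no ¬a (no _)  = refl

  Σ< : ℕ → (ℕ → ℕ) → ℕ
  Σ< zero    f = 0
  Σ< (suc n) f = f n + Σ< n f

  Σ-cong : ∀ n {f g} → (∀ i → i < n → f i ≡ g i) → Σ< n f ≡ Σ< n g
  Σ-cong zero    eq = refl
  Σ-cong (suc n) eq = cong₂ _+_ (eq n ℕₚ.≤-refl) (Σ-cong n (λ i i<n → eq i (ℕₚ.m<n⇒m<1+n i<n)))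

  Σ-+ : ∀ n f g → Σ< n (λ i → f i + g i) ≡ Σ< n f + Σ< n g
  Σ-+ zero    f g = refl
  Σ-+ (suc n) f g = trans (cong (f n + g n +_) (Σ-+ n f g)) (interchange (f n) (g n) (Σ< n f) (Σ< n g))
    where
    interchange : ∀ a b c d → a + b + (c + d) ≡ a + c + (b + d)
    interchange = solve-∀

  Σ-*ˡ : ∀ n c f → Σ< n (λ i → c * f i) ≡ c * Σ< n f
  Σ-*ˡ zero    c f = sym (ℕₚ.*-zeroʳ c)
  Σ-*ˡ (suc n) c f = trans (cong (c * f n +_) (Σ-*ˡ n c f)) (sym (ℕₚ.*-distribˡ-+ c (f n) (Σ< n f)))

  Σ-const : ∀ n c → Σ< n (λ _ → c) ≡ n * c
  Σ-const zero    c = refl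
  Σ-const (suc n) c = cong (c +_) (Σ-const n c)

  Σ-zero : ∀ n {f} → (∀ i → i < n → f i ≡ 0) → Σ< n f ≡ 0
  Σ-zero n eq = trans (Σ-cong n eq) (trans (Σ-const n 0) (ℕₚ.*-zeroʳ n))

  Σ-point : ∀ n {f} w → w < n → (∀ i → i < n → i ≢ w → f i ≡ 0) → Σ< n f ≡ f w
  Σ-point zero    w () _
  Σ-point (suc n) {f} w w<1+n vanish with n ≟ w
  ... | yes refl = trans (cong (f n +_) (Σ-zero n (λ i i<n → vanish i (ℕₚ.m<n⇒m<1+n i<n) (ℕₚ.<⇒≢ i<n))))
                         (ℕₚ.+-identityʳ (f n))
  ... | no n≢w   = trans (cong (_+ Σ< n f) (vanish n ℕₚ.≤-refl n≢w))
                         (Σ-point n w (ℕₚ.≤∧≢⇒< (ℕₚ.≤-pred w<1+n) (n≢w ∘ sym))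
                                  (λ i i<n → vanish i (ℕₚ.m<n⇒m<1+n i<n)))

  private
    rotate : ∀ a b c → a + b + c ≡ c + b + a
    rotate = solve-∀

  Σ-except : ∀ n {w f} c → w < n → (∀ i → i < n → i ≢ w → f i ≡ c) → Σ< n f + c ≡ n * c + f w
  Σ-except zero    c () _
  Σ-except (suc n) {w} {f} c w<1+n elsewhere with n ≟ w
  ... | yes refl = begin
    f n + Σ< n f + c    ≡⟨ cong (λ s → f n + s + c) (trans (Σ-cong n (λ i i<n → elsewhere i (ℕₚ.m<n⇒m<1+n i<n) (ℕₚ.<⇒≢ i<n)))
                                                             (Σ-const n c)) ⟩
    f n + n * c + c     ≡⟨ rotate (f n) (n * c) c ⟩
    c + n * c + f n     ∎
    where open ≡-Reasoning
  ... | no n≢w = begin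
    f n + Σ< n f + c    ≡⟨ ℕₚ.+-assoc (f n) (Σ< n f) c ⟩
    f n + (Σ< n f + c)  ≡⟨ cong₂ _+_ (elsewhere n ℕₚ.≤-refl n≢w)
                                     (Σ-except n c (ℕₚ.≤∧≢⇒< (ℕₚ.≤-pred w<1+n) (n≢w ∘ sym)) (λ i i<n → elsewhere i (ℕₚ.m<n⇒m<1+n i<n))) ⟩
    c + (n * c + f w)   ≡⟨ ℕₚ.+-assoc c (n * c) (f w) ⟨
    c + n * c + f w     ∎
    where open ≡-Reasoning

  Σ-𝟙-≡ : ∀ n {w} → w < n → Σ< n (λ i → 𝟙 (i ≟ w)) ≡ 1
  Σ-𝟙-≡ n {w} w<n = trans (Σ-point n w w<n (λ i _ i≢w → 𝟙-no i≢w (i ≟ w))) (𝟙-yes refl (w ≟ w))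

  Σ-𝟙-unique : ∀ n {w q r} {Q : ℕ → Set q} {R : Set r} (Q? : ∀ i → Dec (Q i)) (R? : Dec R) → w < n →
               (∀ i → i < n → Q i ⇔ (i ≡ w × R)) → Σ< n (𝟙 ∘ Q?) ≡ 𝟙 R?
  Σ-𝟙-unique n {w} Q? R? w<n Q⇔ =
    trans (Σ-point n w w<n (λ i i<n i≢w → 𝟙-no (i≢w ∘ proj₁ ∘ Equivalence.to (Q⇔ i i<n)) (Q? i)))
          (𝟙-cong (mk⇔ (proj₂ ∘ Equivalence.to (Q⇔ w w<n)) (λ r → Equivalence.from (Q⇔ w w<n) (refl , r))) (Q? w) R?)

  Σ-spike : ∀ n {w} f c → w < n → Σ< n (λ i → f i + c * 𝟙 (i ≟ w)) ≡ Σ< n f + c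
  Σ-spike n {w} f c w<n =
    trans (Σ-+ n f (λ i → c * 𝟙 (i ≟ w)))
          (cong (Σ< n f +_) (trans (Σ-*ˡ n c (λ i → 𝟙 (i ≟ w))) (trans (cong (c *_) (Σ-𝟙-≡ n w<n)) (ℕₚ.*-identityʳ c))))

  Σ-𝟙-< : ∀ n {k} → k ≤ n → Σ< n (λ i → 𝟙 (i <? k)) ≡ k
  Σ-𝟙-< zero    z≤n = refl
  Σ-𝟙-< (suc n) {k} k≤1+n with n <? k
  ... | yes n<k = trans (cong suc (trans (Σ-cong n (λ i i<n → 𝟙-yes (ℕₚ.<-trans i<n n<k) (i <? k)))
                                         (trans (Σ-const n 1) (ℕₚ.*-identityʳ n))))
                        (ℕₚ.≤-antisym n<k k≤1+n)
  ... | no n≮k  = Σ-𝟙-< n (ℕₚ.≮⇒≥ n≮k)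

  Σ-split : ∀ m n f → Σ< (m + n) f ≡ Σ< m (λ i → f (n + i)) + Σ< n f
  Σ-split zero    n f = refl
  Σ-split (suc m) n f = trans (cong₂ _+_ (cong f (ℕₚ.+-comm m n)) (Σ-split m n f))
                              (sym (ℕₚ.+-assoc (f (n + m)) _ _))

  Σ-periodic : ∀ m n {f} → (∀ k r → r < n → f (k * n + r) ≡ f r) → Σ< (m * n) f ≡ m * Σ< n f
  Σ-periodic zero    n h = refl
  Σ-periodic (suc m) n {f} h = begin
    Σ< (n + m * n) f                           ≡⟨ Σ-split n (m * n) f ⟩
    Σ< n (λ r → f (m * n + r)) + Σ< (m * n) f  ≡⟨ cong₂ _+_ (Σ-cong n (h m)) (Σ-periodic m n h) ⟩
    Σ< n f + m * Σ< n f                        ∎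
    where open ≡-Reasoning

  module _ {a p} {A : Set a} {P : Pred A p} (P? : Decidable P) where

    length-filter-++ : ∀ xs ys → length (filter P? (xs ++ ys)) ≡ length (filter P? xs) + length (filter P? ys)
    length-filter-++ xs ys = trans (cong length (filter-++ P? xs ys)) (length-++ (filter P? xs))

    length-filter-map : ∀ {b} {B : Set b} (f : B → A) xs → length (filter P? (map f xs)) ≡ length (filter (P? ∘ f) xs)
    length-filter-map f []       = refl
    length-filter-map f (x ∷ xs) with P? (f x)
    ... | yes _ = cong suc (length-filter-map f xs)
    ... | no _  = length-filter-map f xs

  length-filter-downFrom : ∀ {p} {P : Pred ℕ p} (P? : Decidable P) n → length (filter P? (downFrom n)) ≡ Σ< n (𝟙 ∘ P?)
  length-filter-downFrom P? zero    = refl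
  length-filter-downFrom P? (suc n) with P? n
  ... | yes _ = cong suc (length-filter-downFrom P? n)
  ... | no _  = length-filter-downFrom P? n

  length-filter-cartesianProduct : ∀ {b p} {B : Set b} {P : Pred (ℕ × B) p} (P? : Decidable P) n ys →
    length (filter P? (cartesianProduct (downFrom n) ys)) ≡ Σ< n (λ i → length (filter (P? ∘ (i ,_)) ys))
  length-filter-cartesianProduct P? zero    ys = refl
  length-filter-cartesianProduct P? (suc n) ys =
    trans (length-filter-++ P? (map (n ,_) ys) (cartesianProduct (downFrom n) ys))
          (cong₂ _+_ (length-filter-map P? (n ,_) ys) (length-filter-cartesianProduct P? n ys))

module Congruence {p : ℕ} (p-prime : Prime p) where

  open Nat using (_<_; _≤_)
  open import Data.Nat.Coprimality using (prime⇒coprime; coprime-Bézout)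
  open import Data.Nat.GCD using (module Bézout)
  open import Data.Integer.Base using (+_; _+_; _-_; _*_; -_; 0ℤ; 1ℤ; NonZero; _%ℕ_; _/ℕ_)
    renaming (∣_∣ to abs)
  open import Data.Integer.Properties using (abs-*; pos-*; pos-+; +-identityʳ; [+m]-[+n]≡m⊖n; ⊖-≥)
  open import Data.Integer.Divisibility.Signed
  open import Data.Integer.DivMod using (n%ℕd<d; a≡a%ℕn+[a/ℕn]*n)
  open import Data.Integer.Tactic.RingSolver using (solve-∀)

  instance
    p≢0 : Nat.NonZero p
    p≢0 = prime⇒nonZero p-prime

  1<p : 1 < p
  1<p = Nat.nonTrivial⇒n>1 p {{prime⇒nonTrivial p-prime}}

  P : ℤ
  P = + p

  instance
    P≢0 : NonZero P
    P≢0 = p≢0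

  ∣0 : P ∣ 0ℤ
  ∣0 = divides 0ℤ refl

  ∣-≡0 : ∀ {t} → t ≡ 0ℤ → P ∣ t
  ∣-≡0 refl = ∣0

  ∣-negate : ∀ {a} → P ∣ - a → P ∣ a
  ∣-negate {a} P∣-a = subst (P ∣_) (involutive a) (∣m⇒∣-m P∣-a)
    where
    involutive : ∀ a → - - a ≡ a
    involutive = solve-∀

  ∣-sym : ∀ {a b} → P ∣ a - b → P ∣ b - a
  ∣-sym {a} {b} P∣a-b = subst (P ∣_) (swap a b) (∣m⇒∣-m P∣a-b)
    where
    swap : ∀ a b → - (a - b) ≡ b - a
    swap = solve-∀

  ∣-period : ∀ k r → P ∣ + (k Nat.* p Nat.+ r) - + r
  ∣-period k r = divides (+ k) (trans (cong (_- + r) (trans (pos-+ (k Nat.* p) r) (cong (_+ + r) (pos-* k p))))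
                                      (cancel (+ k * P) (+ r)))
    where
    cancel : ∀ a r → a + r - r ≡ a
    cancel = solve-∀

  ∣-lincomb : ∀ {t r s} a b → t ≡ a * r + b * s → P ∣ r → P ∣ s → P ∣ t
  ∣-lincomb a b t≡ P∣r P∣s = subst (P ∣_) (sym t≡) (∣m∣n⇒∣m+n (∣n⇒∣m*n a P∣r) (∣n⇒∣m*n b P∣s))

  ∣-lincomb₃ : ∀ {t r s w} a b c → t ≡ a * r + b * s + c * w → P ∣ r → P ∣ s → P ∣ w → P ∣ t
  ∣-lincomb₃ a b c t≡ P∣r P∣s P∣w =
    subst (P ∣_) (sym t≡) (∣m∣n⇒∣m+n (∣m∣n⇒∣m+n (∣n⇒∣m*n a P∣r) (∣n⇒∣m*n b P∣s)) (∣n⇒∣m*n c P∣w))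

  ∣-euclid : ∀ a b → P ∣ a * b → P ∣ a ⊎ P ∣ b
  ∣-euclid a b P∣ab with euclidsLemma (abs a) (abs b) p-prime (subst (p ℕ∣.∣_) (abs-* a b) (∣⇒∣ᵤ P∣ab))
  ... | inj₁ p∣a = inj₁ (∣ᵤ⇒∣ p∣a)
  ... | inj₂ p∣b = inj₂ (∣ᵤ⇒∣ p∣b)

  ∣-square : ∀ {a} → P ∣ a * a → P ∣ a
  ∣-square {a} P∣aa = [ id , id ]′ (∣-euclid a a P∣aa)

  ∣+n⇒n≡0 : ∀ {n} → n < p → P ∣ + n → n ≡ 0
  ∣+n⇒n≡0 {zero}  _   _    = refl
  ∣+n⇒n≡0 {suc n} n<p P∣n = contradiction (∣⇒∣ᵤ P∣n) (ℕ∣.>⇒∤ n<p)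

  ∤+n : ∀ {n} → n < p → n ≢ 0 → ¬ P ∣ + n
  ∤+n n<p n≢0 = n≢0 ∘ ∣+n⇒n≡0 n<p

  ∤+n² : ∀ {n} → n < p → n ≢ 0 → ¬ P ∣ + n * + n
  ∤+n² n<p n≢0 = ∤+n n<p n≢0 ∘ ∣-square

  private
    ∣+m-+n⇒m≡n-≤ : ∀ {m n} → n ≤ m → m < p → P ∣ + m - + n → m ≡ n
    ∣+m-+n⇒m≡n-≤ {m} {n} n≤m m<p P∣m-n = ℕₚ.≤-antisym (ℕₚ.m∸n≡0⇒m≤n (∣+n⇒n≡0 m∸n<p P∣m∸n)) n≤m
      where
      m∸n<p : m Nat.∸ n < p
      m∸n<p = ℕₚ.≤-<-trans (ℕₚ.m∸n≤m m n) m<p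
      P∣m∸n : P ∣ + (m Nat.∸ n)
      P∣m∸n = subst (P ∣_) (trans ([+m]-[+n]≡m⊖n m n) (⊖-≥ n≤m)) P∣m-n

  ∣+m-+n⇒m≡n : ∀ {m n} → m < p → n < p → P ∣ + m - + n → m ≡ n
  ∣+m-+n⇒m≡n {m} {n} m<p n<p P∣m-n with ℕₚ.≤-total n m
  ... | inj₁ n≤m = ∣+m-+n⇒m≡n-≤ n≤m m<p P∣m-n
  ... | inj₂ m≤n = sym (∣+m-+n⇒m≡n-≤ m≤n n<p (∣-sym {+ m} {+ n} P∣m-n))

  ∣-linear-unique : ∀ {c d m n} → ¬ P ∣ c → m < p → n < p → P ∣ + m * c - d → P ∣ + n * c - d → m ≡ n
  ∣-linear-unique {c} {d} {m} {n} P∤c m<p n<p P∣m P∣n =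
    [ ∣+m-+n⇒m≡n m<p n<p , (λ P∣c → contradiction P∣c P∤c) ]′
      (∣-euclid (+ m - + n) c (∣-lincomb 1ℤ (- 1ℤ) (difference (+ m) (+ n) c d) P∣m P∣n))
    where
    difference : ∀ a b c d → (a - b) * c ≡ 1ℤ * (a * c - d) + (- 1ℤ) * (b * c - d)
    difference = solve-∀

  ∣-residue : ∀ a → P ∣ a - + (a %ℕ p)
  ∣-residue a = divides (a /ℕ p) (cancel (a≡a%ℕn+[a/ℕn]*n a p))
    where
    cancel : ∀ {a r s} → a ≡ r + s → a - r ≡ s
    cancel {r = r} {s} refl = r+s-r≡s r s
      where
      r+s-r≡s : ∀ r s → r + s - r ≡ s
      r+s-r≡s = solve-∀

  ∣-inverse : ∀ {c} → ¬ P ∣ c → ∃[ w ] P ∣ w * c - 1ℤ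
  ∣-inverse {c} P∤c = invert (c %ℕ p) (n%ℕd<d c p) (∣-residue c)
    where
    invert : ∀ r → r < p → P ∣ c - + r → ∃[ w ] P ∣ w * c - 1ℤ
    invert zero      _   P∣c-0 = contradiction (subst (P ∣_) (+-identityʳ c) P∣c-0) P∤c
    invert r@(suc _) r<p P∣c-r with coprime-Bézout (prime⇒coprime p-prime r<p)
    ... | Bézout.+- x y 1+yr≡xp = - + y , ∣-lincomb (- 1ℤ) (- + y) (split (+ y) c (+ r)) P∣1+yr P∣c-r
      where
      split : ∀ y c r → - y * c - 1ℤ ≡ - 1ℤ * (1ℤ + y * r) + (- y) * (c - r)
      split = solve-∀
      P∣1+yr : P ∣ 1ℤ + + y * + r
      P∣1+yr = divides (+ x) (trans (cong (λ t → 1ℤ + t) (sym (pos-* y r)))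
                                (trans (sym (pos-+ 1 (y Nat.* r))) (trans (cong +_ 1+yr≡xp) (pos-* x p))))
    ... | Bézout.-+ x y 1+xp≡yr = + y , ∣-lincomb 1ℤ (+ y) (split (+ y) c (+ r)) P∣yr-1 P∣c-r
      where
      split : ∀ y c r → y * c - 1ℤ ≡ 1ℤ * (y * r - 1ℤ) + y * (c - r)
      split = solve-∀
      cancel : ∀ a → 1ℤ + a - 1ℤ ≡ a
      cancel = solve-∀
      yr≡1+xP : + y * + r ≡ 1ℤ + + x * P
      yr≡1+xP = trans (sym (pos-* y r))
                  (trans (sym (cong +_ 1+xp≡yr)) (trans (pos-+ 1 (x Nat.* p)) (cong (λ t → 1ℤ + t) (pos-* x p))))
      P∣yr-1 : P ∣ + y * + r - 1ℤ
      P∣yr-1 = divides (+ x) (trans (cong (_- 1ℤ) yr≡1+xP) (cancel (+ x * P)))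

  ∣-linear-solvable : ∀ {c} → ¬ P ∣ c → ∀ d → ∃[ n ] n < p × P ∣ + n * c - d
  ∣-linear-solvable {c} P∤c d with ∣-inverse P∤c
  ... | w , P∣wc-1 = (d * w) %ℕ p , n%ℕd<d (d * w) p ,
                     ∣-lincomb (- c) d (combine (+ ((d * w) %ℕ p)) c d w) (∣-residue (d * w)) P∣wc-1
    where
    combine : ∀ n c d w → n * c - d ≡ (- c) * (d * w - n) + d * (w * c - 1ℤ)
    combine = solve-∀

module Admissibility {p : ℕ} (p-prime : Prime p) where

  open Nat using (_<_; _≤_; z≤n; s≤s)
  open import Data.Integer.Base using (+_; _+_; _-_; _*_; -_; 0ℤ; 1ℤ)
  open import Data.Integer.Divisibility.Signed using (_∣_; _∣?_; ∣m⇒∣-m)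
  open import Data.Integer.Tactic.RingSolver using (solve-∀)
  open import Relation.Nullary.Decidable using (_×-dec_)
  open Congruence p-prime

  -- (v , y , u , x , b) are the entries a₁₃, a₀₃, a₁₂, a₀₂ and a₀₁ / p of the matrix.
  Params : Set
  Params = ℕ × ℕ × ℕ × ℕ × ℕ

  Quadratic : (u x b : ℕ) → Set
  Quadratic u x b = P ∣ + b * (+ u * + u - + u) - (+ x * + x - + x)

  quadratic? : ∀ u x b → Dec (Quadratic u x b)
  quadratic? _ _ _ = P ∣? _

  Admissible : Params → Set
  Admissible (v , y , u , x , b) =
    Quadratic u x b × P ∣ + b * (+ u * + v) - + x * + y × P ∣ + b * (+ v * + v) - + y * + y

  admissible? : ∀ t → Dec (Admissible t)
  admissible? (v , y , u , x , b) = quadratic? u x b ×-dec (P ∣? _) ×-dec (P ∣? _)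

  ∣x²-x⇔x<2 : ∀ {x} → x < p → P ∣ + x * + x - + x ⇔ x < 2
  ∣x²-x⇔x<2 {x} x<p = mk⇔ to (from x)
    where
    factor : ∀ x → x * x - x ≡ x * (x - 1ℤ)
    factor = solve-∀
    to : P ∣ + x * + x - + x → x < 2
    to P∣x²-x with ∣-euclid (+ x) (+ x - 1ℤ) (subst (P ∣_) (factor (+ x)) P∣x²-x)
    ... | inj₁ P∣x   = subst (_< 2) (sym (∣+n⇒n≡0 x<p P∣x)) (s≤s z≤n)
    ... | inj₂ P∣x-1 = subst (_< 2) (sym (∣+m-+n⇒m≡n x<p 1<p P∣x-1)) (s≤s (s≤s z≤n))
    from : ∀ x → x < 2 → P ∣ + x * + x - + x
    from 0 _ = ∣0
    from 1 _ = ∣0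
    from (suc (suc _)) (s≤s (s≤s ()))

  admissible-shift : ∀ {v y y′ u x x′ b} → P ∣ + y - + y′ → P ∣ + x - + x′ →
                     Admissible (v , y , u , x , b) → Admissible (v , y′ , u , x′ , b)
  admissible-shift {v} {y} {y′} {u} {x} {x′} {b} P∣y-y′ P∣x-x′ (P∣E₁ , P∣E₂ , P∣E₃) =
    ∣-lincomb 1ℤ (+ x + + x′ - 1ℤ) (shift₁ (+ b) (+ u) (+ x) (+ x′)) P∣E₁ P∣x-x′ ,
    ∣-lincomb₃ 1ℤ (+ y) (+ x′) (shift₂ (+ b) (+ u) (+ v) (+ x) (+ x′) (+ y) (+ y′)) P∣E₂ P∣x-x′ P∣y-y′ ,
    ∣-lincomb 1ℤ (+ y + + y′) (shift₃ (+ b) (+ v) (+ y) (+ y′)) P∣E₃ P∣y-y′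
    where
    shift₁ : ∀ b u x x′ → b * (u * u - u) - (x′ * x′ - x′) ≡
                          1ℤ * (b * (u * u - u) - (x * x - x)) + (x + x′ - 1ℤ) * (x - x′)
    shift₁ = solve-∀
    shift₂ : ∀ b u v x x′ y y′ → b * (u * v) - x′ * y′ ≡
                                 1ℤ * (b * (u * v) - x * y) + y * (x - x′) + x′ * (y - y′)
    shift₂ = solve-∀
    shift₃ : ∀ b v y y′ → b * (v * v) - y′ * y′ ≡ 1ℤ * (b * (v * v) - y * y) + (y + y′) * (y - y′)
    shift₃ = solve-∀

  admissible-periodic : ∀ {v y u x b} k l → Admissible (v , k Nat.* p Nat.+ y , u , l Nat.* p Nat.+ x , b) ⇔ Admissible (v , y , u , x , b)
  admissible-periodic {v} {y} {u} {x} {b} k l = mk⇔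
    (admissible-shift {v} {y′} {y} {u} {x′} {x} {b} (∣-period k y) (∣-period l x))
    (admissible-shift {v} {y} {y′} {u} {x} {x′} {b} (∣-sym {+ y′} {+ y} (∣-period k y)) (∣-sym {+ x′} {+ x} (∣-period l x)))
    where
    y′ x′ : ℕ
    y′ = k Nat.* p Nat.+ y
    x′ = l Nat.* p Nat.+ x

  admissible-v≡0⇔ : ∀ {y u x b} → y < p → Admissible (0 , y , u , x , b) ⇔ (y ≡ 0 × Quadratic u x b)
  admissible-v≡0⇔ {y} {u} {x} {b} y<p = mk⇔ to from
    where
    drop-b : ∀ b y → b * (0ℤ * 0ℤ) - y * y ≡ - (y * y)
    drop-b = solve-∀
    vanish : ∀ b u x → b * (u * 0ℤ) - x * 0ℤ ≡ 0ℤ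
    vanish = solve-∀
    to : Admissible (0 , y , u , x , b) → y ≡ 0 × Quadratic u x b
    to (P∣E₁ , _ , P∣E₃) = ∣+n⇒n≡0 y<p (∣-square (∣-negate (subst (P ∣_) (drop-b (+ b) (+ y)) P∣E₃))) , P∣E₁
    from : y ≡ 0 × Quadratic u x b → Admissible (0 , y , u , x , b)
    from (refl , P∣E₁) = P∣E₁ , ∣-≡0 (vanish (+ b) (+ u) (+ x)) , ∣-≡0 (vanish (+ b) 0ℤ 0ℤ)

  quadratic-u<2⇔ : ∀ {u x b} → u < 2 → x < p → Quadratic u x b ⇔ x < 2
  quadratic-u<2⇔ {u} {x} {b} u<2 x<p = mk⇔
    (Equivalence.to (∣x²-x⇔x<2 x<p) ∘ ∣-negate ∘ subst (P ∣_) (drop-b (+ b) (+ x)) ∘ subst (λ c → P ∣ + b * c - _) (u²-u≡0 u<2))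
    (subst (λ c → P ∣ + b * c - _) (sym (u²-u≡0 u<2)) ∘ subst (P ∣_) (sym (drop-b (+ b) (+ x))) ∘ ∣m⇒∣-m ∘ Equivalence.from (∣x²-x⇔x<2 x<p))
    where
    u²-u≡0 : ∀ {u} → u < 2 → + u * + u - + u ≡ 0ℤ
    u²-u≡0 (s≤s z≤n)       = refl
    u²-u≡0 (s≤s (s≤s z≤n)) = refl
    drop-b : ∀ b x → b * 0ℤ - (x * x - x) ≡ - (x * x - x)
    drop-b = solve-∀

  quadratic-unique : ∀ {u x} → u < p → 2 ≤ u → ∃[ b₀ ] b₀ < p × (∀ {b} → b < p → Quadratic u x b ⇔ b ≡ b₀)
  quadratic-unique {u} {x} u<p 2≤u = unique (∣-linear-solvable P∤u²-u (+ x * + x - + x))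
    where
    P∤u²-u : ¬ P ∣ + u * + u - + u
    P∤u²-u P∣u²-u = ℕₚ.<⇒≱ (Equivalence.to (∣x²-x⇔x<2 u<p) P∣u²-u) 2≤u
    unique : ∃[ b₀ ] b₀ < p × Quadratic u x b₀ → ∃[ b₀ ] b₀ < p × (∀ {b} → b < p → Quadratic u x b ⇔ b ≡ b₀)
    unique (b₀ , b₀<p , P∣E₁) =
      b₀ , b₀<p , λ b<p → mk⇔ (λ P∣E → ∣-linear-unique P∤u²-u b<p b₀<p P∣E P∣E₁) (λ { refl → P∣E₁ })

  admissible-y≡0⇔ : ∀ {v u x b} → v < p → v ≢ 0 → x < p → b < p → Admissible (v , 0 , u , x , b) ⇔ (b ≡ 0 × x < 2)
  admissible-y≡0⇔ {v} {u} {x} {b} v<p v≢0 x<p b<p = mk⇔ to from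
    where
    drop-y : ∀ b c → b * c - 0ℤ * 0ℤ ≡ b * c
    drop-y = solve-∀
    drop-b : ∀ u x → 0ℤ * (u * u - u) - (x * x - x) ≡ - (x * x - x)
    drop-b = solve-∀
    vanish : ∀ u v x → 0ℤ * (u * v) - x * 0ℤ ≡ 0ℤ
    vanish = solve-∀
    b≡0 : P ∣ + b * (+ v * + v) → b ≡ 0
    b≡0 P∣bv² = [ ∣+n⇒n≡0 b<p , (λ P∣v² → contradiction P∣v² (∤+n² v<p v≢0)) ]′ (∣-euclid (+ b) (+ v * + v) P∣bv²)
    to : Admissible (v , 0 , u , x , b) → b ≡ 0 × x < 2
    to (P∣E₁ , _ , P∣E₃) with b≡0 (subst (P ∣_) (drop-y (+ b) (+ v * + v)) P∣E₃)
    ... | refl = refl , Equivalence.to (∣x²-x⇔x<2 x<p) (∣-negate (subst (P ∣_) (drop-b (+ u) (+ x)) P∣E₁))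
    from : b ≡ 0 × x < 2 → Admissible (v , 0 , u , x , b)
    from (refl , x<2) = subst (P ∣_) (sym (drop-b (+ u) (+ x))) (∣m⇒∣-m (Equivalence.from (∣x²-x⇔x<2 x<p) x<2)) ,
                        ∣-≡0 (vanish (+ u) (+ v) (+ x)) , ∣-≡0 (vanish (+ v) (+ v) 0ℤ)

  admissible⇒linear : ∀ {v y u x b} → y < p → y ≢ 0 → Admissible (v , y , u , x , b) → P ∣ + x * + v - + y * + u
  admissible⇒linear {v} {y} {u} {x} {b} y<p y≢0 (_ , P∣E₂ , P∣E₃) =
    [ (λ P∣y → contradiction P∣y (∤+n y<p y≢0)) , id ]′
      (∣-euclid (+ y) _ (∣-lincomb (+ u) (- + v) (identity (+ b) (+ x) (+ y) (+ u) (+ v)) P∣E₃ P∣E₂))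
    where
    identity : ∀ b x y u v → y * (x * v - y * u) ≡ u * (b * (v * v) - y * y) + (- v) * (b * (u * v) - x * y)
    identity = solve-∀

  admissible⇔ : ∀ {v y u x b} → v < p → v ≢ 0 → y < p → y ≢ 0 → u < p →
                P ∣ + b * (+ v * + v) - + y * + y → P ∣ + x * + v - + y * + u →
                Admissible (v , y , u , x , b) ⇔ (u ≡ 0 ⊎ y ≡ v)
  admissible⇔ {v} {y} {u} {x} {b} v<p v≢0 y<p y≢0 u<p P∣E₃ P∣L = mk⇔ to from
    where
    B X Y U V : ℤ
    B = + b; X = + x; Y = + y; U = + u; V = + v
    identity₁ : ∀ b x y u v → y * u * (v - y) ≡
      v * v * (b * (u * u - u) - (x * x - x)) + (u - u * u) * (b * (v * v) - y * y) + (x * v + y * u - v) * (x * v - y * u)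
    identity₁ = solve-∀
    identity₂ : ∀ b x y u v → v * v * (b * (u * u - u) - (x * x - x)) ≡
      1ℤ * (y * u * (v - y)) + (u * u - u) * (b * (v * v) - y * y) + (v - x * v - y * u) * (x * v - y * u)
    identity₂ = solve-∀
    identity₃ : ∀ b x y u v → v * (b * (u * v) - x * y) ≡ u * (b * (v * v) - y * y) + (- y) * (x * v - y * u)
    identity₃ = solve-∀
    u≡0 : P ∣ Y * U → u ≡ 0 ⊎ y ≡ v
    u≡0 P∣yu = [ (λ P∣y → contradiction P∣y (∤+n y<p y≢0)) , inj₁ ∘ ∣+n⇒n≡0 u<p ]′ (∣-euclid Y U P∣yu)
    to : Admissible (v , y , u , x , b) → u ≡ 0 ⊎ y ≡ v
    to (P∣E₁ , _ , _) = [ u≡0 , (λ P∣v-y → inj₂ (sym (∣+m-+n⇒m≡n v<p y<p P∣v-y))) ]′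
      (∣-euclid (Y * U) (V - Y) (∣-lincomb₃ (V * V) (U - U * U) (X * V + Y * U - V) (identity₁ B X Y U V) P∣E₁ P∣E₃ P∣L))
    vanish : u ≡ 0 ⊎ y ≡ v → Y * U * (V - Y) ≡ 0ℤ
    vanish (inj₁ u≡0) = trans (cong (λ u → Y * + u * (V - Y)) u≡0) (at-u≡0 Y V)
      where
      at-u≡0 : ∀ y v → y * 0ℤ * (v - y) ≡ 0ℤ
      at-u≡0 = solve-∀
    vanish (inj₂ y≡v) = trans (cong (λ v → Y * U * (+ v - Y)) (sym y≡v)) (at-y≡v Y U)
      where
      at-y≡v : ∀ y u → y * u * (y - y) ≡ 0ℤ
      at-y≡v = solve-∀
    from : u ≡ 0 ⊎ y ≡ v → Admissible (v , y , u , x , b)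
    from u≡0∨y≡v = P∣E₁ , P∣E₂ , P∣E₃
      where
      P∣E₁ : P ∣ B * (U * U - U) - (X * X - X)
      P∣E₁ = [ (λ P∣v² → contradiction P∣v² (∤+n² v<p v≢0)) , id ]′
               (∣-euclid (V * V) _ (∣-lincomb₃ 1ℤ (U * U - U) (V - X * V - Y * U) (identity₂ B X Y U V)
                                                (∣-≡0 (vanish u≡0∨y≡v)) P∣E₃ P∣L))
      P∣E₂ : P ∣ B * (U * V) - X * Y
      P∣E₂ = [ (λ P∣v → contradiction P∣v (∤+n v<p v≢0)) , id ]′
               (∣-euclid V _ (∣-lincomb U (- Y) (identity₃ B X Y U V) P∣E₃ P∣L))

  admissible-v,y≢0⇔ : ∀ {v y u} → v < p → v ≢ 0 → y < p → y ≢ 0 → u < p →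
    ∃[ x₀ ] ∃[ b₀ ] x₀ < p × b₀ < p ×
      (∀ {x b} → x < p → b < p → Admissible (v , y , u , x , b) ⇔ (b ≡ b₀ × x ≡ x₀ × (u ≡ 0 ⊎ y ≡ v)))
  admissible-v,y≢0⇔ {v} {y} {u} v<p v≢0 y<p y≢0 u<p =
    characterise (∣-linear-solvable (∤+n v<p v≢0) (+ y * + u)) (∣-linear-solvable (∤+n² v<p v≢0) (+ y * + y))
    where
    characterise : ∃[ x₀ ] x₀ < p × P ∣ + x₀ * + v - + y * + u →
                   ∃[ b₀ ] b₀ < p × P ∣ + b₀ * (+ v * + v) - + y * + y →
                   ∃[ x₀ ] ∃[ b₀ ] x₀ < p × b₀ < p ×
                     (∀ {x b} → x < p → b < p → Admissible (v , y , u , x , b) ⇔ (b ≡ b₀ × x ≡ x₀ × (u ≡ 0 ⊎ y ≡ v)))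
    characterise (x₀ , x₀<p , P∣L₀) (b₀ , b₀<p , P∣E₃₀) = x₀ , b₀ , x₀<p , b₀<p , λ {x} {b} x<p b<p → mk⇔ (to x<p b<p) (from {x} {b})
      where
      to : ∀ {x b} → x < p → b < p → Admissible (v , y , u , x , b) → b ≡ b₀ × x ≡ x₀ × (u ≡ 0 ⊎ y ≡ v)
      to {x} {b} x<p b<p admissible@(_ , _ , P∣E₃) =
        ∣-linear-unique (∤+n² v<p v≢0) b<p b₀<p P∣E₃ P∣E₃₀ ,
        ∣-linear-unique (∤+n v<p v≢0) x<p x₀<p P∣L P∣L₀ ,
        Equivalence.to (admissible⇔ {v} {y} {u} {x} {b} v<p v≢0 y<p y≢0 u<p P∣E₃ P∣L) admissible
        where
        P∣L : P ∣ + x * + v - + y * + u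
        P∣L = admissible⇒linear {v} {y} {u} {x} {b} y<p y≢0 admissible
      from : ∀ {x b} → b ≡ b₀ × x ≡ x₀ × (u ≡ 0 ⊎ y ≡ v) → Admissible (v , y , u , x , b)
      from (refl , refl , u≡0∨y≡v) = Equivalence.from (admissible⇔ {v} {y} {u} {x₀} {b₀} v<p v≢0 y<p y≢0 u<p P∣E₃₀ P∣L₀) u≡0∨y≡v

module Cancellation where

  open import Data.Integer.Base using (_+_; _-_; _*_; NonZero)
  open import Data.Integer.Properties using (*-cancelˡ-≡)
  open import Data.Integer.Tactic.RingSolver using (solve-∀)

  cancel-top : ∀ d {a b t t′ c} → t ≡ t′ → d * a + t ≡ d * b + t′ + c → c ≡ (a - b) * d
  cancel-top d {a} {b} {t} {c = c} refl eq = begin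
    c                          ≡⟨ added (d * b + t) c ⟩
    d * b + t + c - (d * b + t) ≡⟨ cong (_- (d * b + t)) eq ⟨
    d * a + t - (d * b + t)     ≡⟨ difference d a b t ⟩
    (a - b) * d                 ∎
    where
    open ≡-Reasoning
    added : ∀ x c → c ≡ x + c - x
    added = solve-∀
    difference : ∀ d a b t → d * a + t - (d * b + t) ≡ (a - b) * d
    difference = solve-∀

  cancel-diagonal : ∀ d {a b t t′} .{{_ : NonZero d}} → t ≡ t′ → d * a + t ≡ d * b + t′ → a ≡ b
  cancel-diagonal d {a} {b} {t} refl eq = *-cancelˡ-≡ d a b (begin
    d * a          ≡⟨ add-sub (d * a) t ⟨
    d * a + t - t  ≡⟨ cong (_- t) eq ⟩
    d * b + t - t  ≡⟨ add-sub (d * b) t ⟩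
    d * b          ∎)
    where
    open ≡-Reasoning
    add-sub : ∀ x t → x + t - t ≡ x
    add-sub = solve-∀

module ColumnSpan (P A X Y U V : ℤ) where

  open import Data.Fin.Base using (_<_)
  open import Data.Fin.Properties using (_≟_)
  open import Data.Bool.Base using (if_then_else_)
  open import Relation.Nullary.Decidable using (⌊_⌋)
  open Nat using (s≤s)
  open import Data.Integer.Base using (_+_; _-_; _*_; -_; 0ℤ; 1ℤ; NonZero)
  open import Data.Integer.Properties using (i*j≢0)
  open import Data.Integer.Divisibility.Signed using (_∣_; divides; module _∣_; ∣m∣n⇒∣m+n; ∣n⇒∣m*n)
  open import Data.Integer.Tactic.RingSolver using (solve-∀)
  open Cancellation

  -- The shape of an irreducible subring matrix with diagonal (3, 2, 1, 3), where A, X, Y, U, V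
  -- stand for a₀₁, a₀₂, a₀₃, a₁₂, a₁₃; the entry (2, 3) vanishes since a₂₃ < p⁰.
  M : Matrix 5
  M = (P * P * P ∷ P * A ∷ P * X ∷ P * Y     ∷ 1ℤ ∷ []) ∷
      (0ℤ        ∷ P * P ∷ P * U ∷ P * V     ∷ 1ℤ ∷ []) ∷
      (0ℤ        ∷ 0ℤ    ∷ P     ∷ 0ℤ        ∷ 1ℤ ∷ []) ∷
      (0ℤ        ∷ 0ℤ    ∷ 0ℤ    ∷ P * P * P ∷ 1ℤ ∷ []) ∷
      (0ℤ        ∷ 0ℤ    ∷ 0ℤ    ∷ 0ℤ        ∷ 1ℤ ∷ []) ∷ []

  M-lower : ∀ i j → j < i → entry M i j ≡ 0ℤ
  M-lower 0F j ()
  M-lower 1F 0F _ = refl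
  M-lower 2F 0F _ = refl
  M-lower 2F 1F _ = refl
  M-lower 3F 0F _ = refl
  M-lower 3F 1F _ = refl
  M-lower 3F 2F _ = refl
  M-lower 4F 0F _ = refl
  M-lower 4F 1F _ = refl
  M-lower 4F 2F _ = refl
  M-lower 4F 3F _ = refl
  M-lower 1F (suc j) (s≤s ())
  M-lower 2F (suc (suc j)) (s≤s (s≤s ()))
  M-lower 3F (suc (suc (suc j))) (s≤s (s≤s (s≤s ())))
  M-lower 4F (suc (suc (suc (suc j)))) (s≤s (s≤s (s≤s (s≤s ()))))

  M-lastCol : ∀ i → entry M i 4F ≡ 1ℤ
  M-lastCol 0F = refl
  M-lastCol 1F = refl
  M-lastCol 2F = refl
  M-lastCol 3F = refl
  M-lastCol 4F = refl

  span : (Fin 5 → ℤ) → Fin 5 → ℤ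
  span z 0F = P * P * P * z 0F + (P * A * z 1F + P * X * z 2F + P * Y * z 3F + z 4F)
  span z 1F = P * P * z 1F + (P * U * z 2F + P * V * z 3F + z 4F)
  span z 2F = P * z 2F + z 4F
  span z 3F = P * P * P * z 3F + z 4F
  span z 4F = z 4F

  colComb-M : ∀ z k → colComb M z k ≡ span z k
  colComb-M z 0F = row₀ P A X Y (z 0F) (z 1F) (z 2F) (z 3F) (z 4F)
    where
    row₀ : ∀ P A X Y z₀ z₁ z₂ z₃ z₄ →
           P * P * P * z₀ + (P * A * z₁ + (P * X * z₂ + (P * Y * z₃ + (1ℤ * z₄ + 0ℤ)))) ≡
           P * P * P * z₀ + (P * A * z₁ + P * X * z₂ + P * Y * z₃ + z₄)
    row₀ = solve-∀
  colComb-M z 1F = row₁ P U V (z 0F) (z 1F) (z 2F) (z 3F) (z 4F)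
    where
    row₁ : ∀ P U V z₀ z₁ z₂ z₃ z₄ →
           0ℤ * z₀ + (P * P * z₁ + (P * U * z₂ + (P * V * z₃ + (1ℤ * z₄ + 0ℤ)))) ≡
           P * P * z₁ + (P * U * z₂ + P * V * z₃ + z₄)
    row₁ = solve-∀
  colComb-M z 2F = row₂ P (z 0F) (z 1F) (z 2F) (z 3F) (z 4F)
    where
    row₂ : ∀ P z₀ z₁ z₂ z₃ z₄ → 0ℤ * z₀ + (0ℤ * z₁ + (P * z₂ + (0ℤ * z₃ + (1ℤ * z₄ + 0ℤ)))) ≡ P * z₂ + z₄
    row₂ = solve-∀
  colComb-M z 3F = row₃ P (z 0F) (z 1F) (z 2F) (z 3F) (z 4F)
    where
    row₃ : ∀ P z₀ z₁ z₂ z₃ z₄ →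
           0ℤ * z₀ + (0ℤ * z₁ + (0ℤ * z₂ + (P * P * P * z₃ + (1ℤ * z₄ + 0ℤ)))) ≡ P * P * P * z₃ + z₄
    row₃ = solve-∀
  colComb-M z 4F = row₄ (z 0F) (z 1F) (z 2F) (z 3F) (z 4F)
    where
    row₄ : ∀ z₀ z₁ z₂ z₃ z₄ → 0ℤ * z₀ + (0ℤ * z₁ + (0ℤ * z₂ + (0ℤ * z₃ + (1ℤ * z₄ + 0ℤ)))) ≡ z₄
    row₄ = solve-∀

  -- Writing each product c_j ∘ c_l of columns of M as a combination of columns that is exact in
  -- rows 1 to 4 yields the coefficients x ⊙ y for (M x) ∘ (M y); R_jl is what the combination
  -- for c_j ∘ c_l misses in row 0.
  _⊙_ : (x y : Fin 5 → ℤ) → Fin 5 → ℤ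
  (x ⊙ y) 0F = x 0F * y 4F + x 4F * y 0F + P * P * P * (x 0F * y 0F) + P * A * (x 0F * y 1F + x 1F * y 0F)
             + P * X * (x 0F * y 2F + x 2F * y 0F) + P * Y * (x 0F * y 3F + x 3F * y 0F)
  (x ⊙ y) 1F = x 1F * y 4F + x 4F * y 1F + P * P * (x 1F * y 1F) + P * U * (x 1F * y 2F + x 2F * y 1F)
             + P * V * (x 1F * y 3F + x 3F * y 1F) + (U * U - U) * (x 2F * y 2F)
             + U * V * (x 2F * y 3F + x 3F * y 2F) + (V * V - P * P * V) * (x 3F * y 3F)
  (x ⊙ y) 2F = x 2F * y 4F + x 4F * y 2F + P * (x 2F * y 2F)
  (x ⊙ y) 3F = x 3F * y 4F + x 4F * y 3F + P * P * P * (x 3F * y 3F)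
  (x ⊙ y) 4F = x 4F * y 4F

  R₁₁ R₁₂ R₁₃ R₂₂ R₂₃ R₃₃ : ℤ
  R₁₁ = P * A * (P * A) - P * P * (P * A)
  R₁₂ = P * A * (P * X) - P * U * (P * A)
  R₁₃ = P * A * (P * Y) - P * V * (P * A)
  R₂₂ = P * X * (P * X) - P * (P * X) - (U * U - U) * (P * A)
  R₂₃ = P * X * (P * Y) - U * V * (P * A)
  R₃₃ = P * Y * (P * Y) - P * P * P * (P * Y) - (V * V - P * P * V) * (P * A)

  residue : (x y : Fin 5 → ℤ) → ℤ
  residue x y = x 1F * y 1F * R₁₁ + (x 1F * y 2F + x 2F * y 1F) * R₁₂ + (x 1F * y 3F + x 3F * y 1F) * R₁₃
              + x 2F * y 2F * R₂₂ + (x 2F * y 3F + x 3F * y 2F) * R₂₃ + x 3F * y 3F * R₃₃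

  span-⊙-top : ∀ x y → span x 0F * span y 0F ≡ span (x ⊙ y) 0F + residue x y
  span-⊙-top x y = identity P A X Y U V (x 0F) (x 1F) (x 2F) (x 3F) (x 4F) (y 0F) (y 1F) (y 2F) (y 3F) (y 4F)
    where
    identity : ∀ P A X Y U V x₀ x₁ x₂ x₃ x₄ y₀ y₁ y₂ y₃ y₄ →
      (P * P * P * x₀ + (P * A * x₁ + P * X * x₂ + P * Y * x₃ + x₄)) *
      (P * P * P * y₀ + (P * A * y₁ + P * X * y₂ + P * Y * y₃ + y₄)) ≡
      P * P * P * (x₀ * y₄ + x₄ * y₀ + P * P * P * (x₀ * y₀) + P * A * (x₀ * y₁ + x₁ * y₀)
                   + P * X * (x₀ * y₂ + x₂ * y₀) + P * Y * (x₀ * y₃ + x₃ * y₀))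
      + (P * A * (x₁ * y₄ + x₄ * y₁ + P * P * (x₁ * y₁) + P * U * (x₁ * y₂ + x₂ * y₁)
                  + P * V * (x₁ * y₃ + x₃ * y₁) + (U * U - U) * (x₂ * y₂)
                  + U * V * (x₂ * y₃ + x₃ * y₂) + (V * V - P * P * V) * (x₃ * y₃))
         + P * X * (x₂ * y₄ + x₄ * y₂ + P * (x₂ * y₂))
         + P * Y * (x₃ * y₄ + x₄ * y₃ + P * P * P * (x₃ * y₃))
         + x₄ * y₄)
      + (x₁ * y₁ * (P * A * (P * A) - P * P * (P * A))
         + (x₁ * y₂ + x₂ * y₁) * (P * A * (P * X) - P * U * (P * A))
         + (x₁ * y₃ + x₃ * y₁) * (P * A * (P * Y) - P * V * (P * A))
         + x₂ * y₂ * (P * X * (P * X) - P * (P * X) - (U * U - U) * (P * A))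
         + (x₂ * y₃ + x₃ * y₂) * (P * X * (P * Y) - U * V * (P * A))
         + x₃ * y₃ * (P * Y * (P * Y) - P * P * P * (P * Y) - (V * V - P * P * V) * (P * A)))
    identity = solve-∀

  span-⊙-below : ∀ x y k → span x (suc k) * span y (suc k) ≡ span (x ⊙ y) (suc k)
  span-⊙-below x y 0F = identity P U V (x 1F) (x 2F) (x 3F) (x 4F) (y 1F) (y 2F) (y 3F) (y 4F)
    where
    identity : ∀ P U V x₁ x₂ x₃ x₄ y₁ y₂ y₃ y₄ →
      (P * P * x₁ + (P * U * x₂ + P * V * x₃ + x₄)) * (P * P * y₁ + (P * U * y₂ + P * V * y₃ + y₄)) ≡
      P * P * (x₁ * y₄ + x₄ * y₁ + P * P * (x₁ * y₁) + P * U * (x₁ * y₂ + x₂ * y₁)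
               + P * V * (x₁ * y₃ + x₃ * y₁) + (U * U - U) * (x₂ * y₂)
               + U * V * (x₂ * y₃ + x₃ * y₂) + (V * V - P * P * V) * (x₃ * y₃))
      + (P * U * (x₂ * y₄ + x₄ * y₂ + P * (x₂ * y₂))
         + P * V * (x₃ * y₄ + x₄ * y₃ + P * P * P * (x₃ * y₃))
         + x₄ * y₄)
    identity = solve-∀
  span-⊙-below x y 1F = identity P (x 2F) (x 4F) (y 2F) (y 4F)
    where
    identity : ∀ P x₂ x₄ y₂ y₄ → (P * x₂ + x₄) * (P * y₂ + y₄) ≡ P * (x₂ * y₄ + x₄ * y₂ + P * (x₂ * y₂)) + x₄ * y₄
    identity = solve-∀
  span-⊙-below x y 2F = identity P (x 3F) (x 4F) (y 3F) (y 4F)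
    where
    identity : ∀ P x₃ x₄ y₃ y₄ →
      (P * P * P * x₃ + x₄) * (P * P * P * y₃ + y₄) ≡ P * P * P * (x₃ * y₄ + x₄ * y₃ + P * P * P * (x₃ * y₃)) + x₄ * y₄
    identity = solve-∀
  span-⊙-below x y 3F = refl

  span-product⇒closed-at : ∀ {x y z} → (∀ k → span x k * span y k ≡ span z k) →
                           ∀ k → colComb M x k * colComb M y k ≡ colComb M z k
  span-product⇒closed-at {x} {y} {z} h k =
    trans (cong₂ _*_ (colComb-M x k) (colComb-M y k)) (trans (h k) (sym (colComb-M z k)))

  raise₀ : ℤ → (Fin 5 → ℤ) → Fin 5 → ℤ
  raise₀ t z 0F      = z 0F + t
  raise₀ t z (suc k) = z (suc k)

  span-raise₀ : ∀ t z → span (raise₀ t z) 0F ≡ span z 0F + t * (P * P * P)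
  span-raise₀ t z = identity P A X Y (z 0F) (z 1F) (z 2F) (z 3F) (z 4F) t
    where
    identity : ∀ P A X Y z₀ z₁ z₂ z₃ z₄ t →
      P * P * P * (z₀ + t) + (P * A * z₁ + P * X * z₂ + P * Y * z₃ + z₄) ≡
      P * P * P * z₀ + (P * A * z₁ + P * X * z₂ + P * Y * z₃ + z₄) + t * (P * P * P)
    identity = solve-∀

  ResiduesDivisible : Set
  ResiduesDivisible = P * P * P ∣ R₁₁ × P * P * P ∣ R₁₂ × P * P * P ∣ R₁₃ ×
                      P * P * P ∣ R₂₂ × P * P * P ∣ R₂₃ × P * P * P ∣ R₃₃

  residues-divisible⇒residue-divisible : ResiduesDivisible → ∀ x y → P * P * P ∣ residue x y
  residues-divisible⇒residue-divisible (d₁₁ , d₁₂ , d₁₃ , d₂₂ , d₂₃ , d₃₃) x y =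
    ∣m∣n⇒∣m+n (∣m∣n⇒∣m+n (∣m∣n⇒∣m+n (∣m∣n⇒∣m+n (∣m∣n⇒∣m+n
      (∣n⇒∣m*n (x 1F * y 1F) d₁₁)
      (∣n⇒∣m*n (x 1F * y 2F + x 2F * y 1F) d₁₂))
      (∣n⇒∣m*n (x 1F * y 3F + x 3F * y 1F) d₁₃))
      (∣n⇒∣m*n (x 2F * y 2F) d₂₂))
      (∣n⇒∣m*n (x 2F * y 3F + x 3F * y 2F) d₂₃))
      (∣n⇒∣m*n (x 3F * y 3F) d₃₃)

  residues-divisible⇒closed : ResiduesDivisible → ColumnSpanMulClosed M
  residues-divisible⇒closed divisible x y = raise₀ q (x ⊙ y) , span-product⇒closed-at product
    where
    open _∣_ (residues-divisible⇒residue-divisible divisible x y) renaming (quotient to q)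
    product : ∀ k → span x k * span y k ≡ span (raise₀ q (x ⊙ y)) k
    product 0F = begin
      span x 0F * span y 0F              ≡⟨ span-⊙-top x y ⟩
      span (x ⊙ y) 0F + residue x y      ≡⟨ cong (span (x ⊙ y) 0F +_) equality ⟩
      span (x ⊙ y) 0F + q * (P * P * P)  ≡⟨ span-raise₀ q (x ⊙ y) ⟨
      span (raise₀ q (x ⊙ y)) 0F         ∎
      where open ≡-Reasoning
    product 1F = span-⊙-below x y 0F
    product 2F = span-⊙-below x y 1F
    product 3F = span-⊙-below x y 2F
    product 4F = span-⊙-below x y 3F

  module _ .{{_ : NonZero P}} where

    private
      instance
        P²≢0 : NonZero (P * P)
        P²≢0 = i*j≢0 P P
        P³≢0 : NonZero (P * P * P)
        P³≢0 = i*j≢0 (P * P) P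

    back-substitution : ∀ {z w c} → (∀ k → span z (suc k) ≡ span w (suc k)) →
                        span z 0F ≡ span w 0F + c → c ≡ (z 0F - w 0F) * (P * P * P)
    back-substitution {z} {w} {c} below = cancel-top (P * P * P) tail-z≡tail-w
      where
      z₄≡w₄ : z 4F ≡ w 4F
      z₄≡w₄ = below 3F
      z₃≡w₃ : z 3F ≡ w 3F
      z₃≡w₃ = cancel-diagonal (P * P * P) z₄≡w₄ (below 2F)
      z₂≡w₂ : z 2F ≡ w 2F
      z₂≡w₂ = cancel-diagonal P z₄≡w₄ (below 1F)
      z₁≡w₁ : z 1F ≡ w 1F
      z₁≡w₁ = cancel-diagonal (P * P) (cong₂ _+_ (cong₂ _+_ (cong (P * U *_) z₂≡w₂) (cong (P * V *_) z₃≡w₃)) z₄≡w₄)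
                (below 0F)
      tail-z≡tail-w : P * A * z 1F + P * X * z 2F + P * Y * z 3F + z 4F ≡ P * A * w 1F + P * X * w 2F + P * Y * w 3F + w 4F
      tail-z≡tail-w = cong₂ _+_ (cong₂ _+_ (cong₂ _+_ (cong (P * A *_) z₁≡w₁) (cong (P * X *_) z₂≡w₂))
                                           (cong (P * Y *_) z₃≡w₃)) z₄≡w₄

    closed⇒residue-divisible : ColumnSpanMulClosed M → ∀ x y → P * P * P ∣ residue x y
    closed⇒residue-divisible closed x y = divides (z 0F - (x ⊙ y) 0F) (back-substitution below top)
      where
      z : Fin 5 → ℤ
      z = proj₁ (closed x y)
      product : ∀ k → span x k * span y k ≡ span z k
      product k = trans (cong₂ _*_ (sym (colComb-M x k)) (sym (colComb-M y k)))
                        (trans (proj₂ (closed x y) k) (colComb-M z k))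
      below : ∀ k → span z (suc k) ≡ span (x ⊙ y) (suc k)
      below k = trans (sym (product (suc k))) (span-⊙-below x y k)
      top : span z 0F ≡ span (x ⊙ y) 0F + residue x y
      top = trans (sym (product 0F)) (span-⊙-top x y)

    closed⇒residues-divisible : ColumnSpanMulClosed M → ResiduesDivisible
    closed⇒residues-divisible closed =
      at 1F 1F (coordinate₁ R₁₁ R₁₂ R₁₃ R₂₂ R₂₃ R₃₃) , at 1F 2F (coordinate₂ R₁₁ R₁₂ R₁₃ R₂₂ R₂₃ R₃₃) ,
      at 1F 3F (coordinate₃ R₁₁ R₁₂ R₁₃ R₂₂ R₂₃ R₃₃) , at 2F 2F (coordinate₄ R₁₁ R₁₂ R₁₃ R₂₂ R₂₃ R₃₃) ,
      at 2F 3F (coordinate₅ R₁₁ R₁₂ R₁₃ R₂₂ R₂₃ R₃₃) , at 3F 3F (coordinate₆ R₁₁ R₁₂ R₁₃ R₂₂ R₂₃ R₃₃)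
      where
      e : Fin 5 → Fin 5 → ℤ
      e i j = if ⌊ i ≟ j ⌋ then 1ℤ else 0ℤ
      at : ∀ {r} j l → residue (e j) (e l) ≡ r → P * P * P ∣ r
      at j l eq = subst (P * P * P ∣_) eq (closed⇒residue-divisible closed (e j) (e l))
      coordinate₁ : ∀ a b c d e f → 1ℤ * a + 0ℤ * b + 0ℤ * c + 0ℤ * d + 0ℤ * e + 0ℤ * f ≡ a
      coordinate₁ = solve-∀
      coordinate₂ : ∀ a b c d e f → 0ℤ * a + 1ℤ * b + 0ℤ * c + 0ℤ * d + 0ℤ * e + 0ℤ * f ≡ b
      coordinate₂ = solve-∀
      coordinate₃ : ∀ a b c d e f → 0ℤ * a + 0ℤ * b + 1ℤ * c + 0ℤ * d + 0ℤ * e + 0ℤ * f ≡ c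
      coordinate₃ = solve-∀
      coordinate₄ : ∀ a b c d e f → 0ℤ * a + 0ℤ * b + 0ℤ * c + 1ℤ * d + 0ℤ * e + 0ℤ * f ≡ d
      coordinate₄ = solve-∀
      coordinate₅ : ∀ a b c d e f → 0ℤ * a + 0ℤ * b + 0ℤ * c + 0ℤ * d + 1ℤ * e + 0ℤ * f ≡ e
      coordinate₅ = solve-∀
      coordinate₆ : ∀ a b c d e f → 0ℤ * a + 0ℤ * b + 0ℤ * c + 0ℤ * d + 0ℤ * e + 1ℤ * f ≡ f
      coordinate₆ = solve-∀

module MatrixRegions where

  open import Data.Fin.Base using (_<_; toℕ)
  open import Data.Fin.Properties using (toℕ-inject₁; toℕ-fromℕ; <-cmp; inject₁ℕ<)
  open import Data.Vec.Properties using (tabulate∘lookup; tabulate-cong)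
  open import Relation.Binary.Definitions using (tri<; tri≈; tri>)

  data LastOrInject : ∀ {m} → Fin (suc m) → Set where
    last   : ∀ {m} → LastOrInject (fromℕ m)
    inject : ∀ {m} (i : Fin m) → LastOrInject (inject₁ i)

  lastOrInject : ∀ {m} (i : Fin (suc m)) → LastOrInject i
  lastOrInject {zero}  zero    = last
  lastOrInject {suc m} zero    = inject zero
  lastOrInject {suc m} (suc i) with lastOrInject i
  ... | last     = last
  ... | inject j = inject (suc j)

  lookup-ext : ∀ {a} {A : Set a} {n} {xs ys : Vec A n} → (∀ i → lookup xs i ≡ lookup ys i) → xs ≡ ys
  lookup-ext {xs = xs} {ys} eq = trans (sym (tabulate∘lookup xs)) (trans (tabulate-cong eq) (tabulate∘lookup ys))

  inject₁-mono-< : ∀ {m} {i j : Fin m} → i < j → inject₁ i < inject₁ j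
  inject₁-mono-< {i = i} {j} i<j = subst₂ Nat._<_ (sym (toℕ-inject₁ i)) (sym (toℕ-inject₁ j)) i<j

  inject₁<fromℕ : ∀ {m} (i : Fin m) → inject₁ i < fromℕ m
  inject₁<fromℕ {m} i = subst (toℕ (inject₁ i) Nat.<_) (sym (toℕ-fromℕ m)) (inject₁ℕ< i)

  entries-by-region⇒≡ : ∀ {m} {A B : Matrix (suc m)} →
    (∀ i j → j < i → entry A i j ≡ entry B i j) →
    (∀ i → entry A (inject₁ i) (inject₁ i) ≡ entry B (inject₁ i) (inject₁ i)) →
    (∀ i → entry A i (fromℕ m) ≡ entry B i (fromℕ m)) →
    (∀ i j → i < j → entry A (inject₁ i) (inject₁ j) ≡ entry B (inject₁ i) (inject₁ j)) →
    A ≡ B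
  entries-by-region⇒≡ {m} {A} {B} lower diagonal lastColumn upper = lookup-ext (λ i → lookup-ext (entries i))
    where
    entries : ∀ i j → entry A i j ≡ entry B i j
    entries i j with lastOrInject i | lastOrInject j
    ... | _         | last      = lastColumn i
    ... | last      | inject j′ = lower (fromℕ m) (inject₁ j′) (inject₁<fromℕ j′)
    ... | inject i′ | inject j′ with <-cmp i′ j′
    ...   | tri< i<j _ _    = upper i′ j′ i<j
    ...   | tri≈ _ refl _   = diagonal i′
    ...   | tri> _ _ j<i    = lower (inject₁ i′) (inject₁ j′) (inject₁-mono-< j<i)

module Classification {p : ℕ} (p-prime : Prime p) where

  open Nat using (_<_; _^_; _∸_; z≤n; s≤s)
  open import Data.Fin.Base using () renaming (_<_ to _<ᶠ_)
  open import Data.Integer.Base using (+_; _+_; _-_; _*_; -_; 1ℤ; NonZero)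
    renaming (_^_ to _^ℤ_)
  open import Data.Integer.Properties using (pos-*; *-cancelˡ-≡; +-injective; i*j≢0; *-identityʳ)
  open import Data.Integer.Divisibility.Signed using (_∣_; divides; ∣-refl; ∣m⇒∣-m; *-monoʳ-∣; *-cancelˡ-∣; ∣⇒∣ᵤ)
  open import Data.Integer.Tactic.RingSolver using (solve-∀)
  open Congruence p-prime
  open Admissibility p-prime
  open MatrixRegions

  α : Vec ℕ 4
  α = 3 ∷ 2 ∷ 1 ∷ 3 ∷ []

  private
    instance
      P²≢0 : NonZero (P * P)
      P²≢0 = i*j≢0 P P

  closed⇒P∣A : ∀ {A X Y U V} → ColumnSpanMulClosed (ColumnSpan.M P A X Y U V) → P ∣ A
  closed⇒P∣A {A} {X} {Y} {U} {V} closed =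
    [ id , (λ P∣A-P → ∣-lincomb 1ℤ 1ℤ (shift A P) P∣A-P ∣-refl) ]′ (∣-euclid A (A - P) P∣A[A-P])
    where
    open ColumnSpan P A X Y U V using (closed⇒residues-divisible)
    factor : ∀ P A → P * A * (P * A) - P * P * (P * A) ≡ P * P * (A * (A - P))
    factor = solve-∀
    shift : ∀ A P → A ≡ 1ℤ * (A - P) + 1ℤ * P
    shift = solve-∀
    P∣A[A-P] : P ∣ A * (A - P)
    P∣A[A-P] = *-cancelˡ-∣ (P * P) (subst (P * P * P ∣_) (factor P A) (proj₁ (closed⇒residues-divisible closed)))

  residues-divisible⇔admissible : ∀ {v y u x b} →
    ColumnSpan.ResiduesDivisible P (P * + b) (+ x) (+ y) (+ u) (+ v) ⇔ Admissible (v , y , u , x , b)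
  residues-divisible⇔admissible {v} {y} {u} {x} {b} = mk⇔ to from
    where
    B X Y U V : ℤ
    B = + b; X = + x; Y = + y; U = + u; V = + v
    open ColumnSpan P (P * B) X Y U V using (ResiduesDivisible)
    E₁ E₂ E₃ : ℤ
    E₁ = B * (U * U - U) - (X * X - X)
    E₂ = B * (U * V) - X * Y
    E₃ = B * (V * V) - Y * Y
    R₁₁≡ : ∀ P B → P * (P * B) * (P * (P * B)) - P * P * (P * (P * B)) ≡ P * (B * B - B) * (P * P * P)
    R₁₁≡ = solve-∀
    R₁ⱼ≡ : ∀ P B X U → P * (P * B) * (P * X) - P * U * (P * (P * B)) ≡ B * (X - U) * (P * P * P)
    R₁ⱼ≡ = solve-∀
    R₂₂≡ : ∀ P B X U → P * X * (P * X) - P * (P * X) - (U * U - U) * (P * (P * B)) ≡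
                       P * P * (- (B * (U * U - U) - (X * X - X)))
    R₂₂≡ = solve-∀
    R₂₃≡ : ∀ P B X Y U V → P * X * (P * Y) - U * V * (P * (P * B)) ≡ P * P * (- (B * (U * V) - X * Y))
    R₂₃≡ = solve-∀
    R₃₃≡ : ∀ P B Y V → P * Y * (P * Y) - P * P * P * (P * Y) - (V * V - P * P * V) * (P * (P * B)) ≡
                       P * P * (P * (P * (B * V - Y)) - (B * (V * V) - Y * Y))
    R₃₃≡ = solve-∀
    unshift : ∀ P W E → E ≡ P * W * P + (- 1ℤ) * (P * (P * W) - E)
    unshift = solve-∀
    divisible : ∀ {R t} → R ≡ P * P * t → P ∣ t → P * P * P ∣ R
    divisible R≡ P∣t = subst (P * P * P ∣_) (sym R≡) (*-monoʳ-∣ (P * P) P∣t)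
    divisible⁻¹ : ∀ {R t} → R ≡ P * P * t → P * P * P ∣ R → P ∣ t
    divisible⁻¹ R≡ P³∣R = *-cancelˡ-∣ (P * P) (subst (P * P * P ∣_) R≡ P³∣R)
    to : ResiduesDivisible → Admissible (v , y , u , x , b)
    to (_ , _ , _ , d₂₂ , d₂₃ , d₃₃) =
      ∣-negate (divisible⁻¹ (R₂₂≡ P B X U) d₂₂) ,
      ∣-negate (divisible⁻¹ (R₂₃≡ P B X Y U V) d₂₃) ,
      ∣-lincomb (P * (B * V - Y)) (- 1ℤ) (unshift P (B * V - Y) E₃) ∣-refl (divisible⁻¹ (R₃₃≡ P B Y V) d₃₃)
    from : Admissible (v , y , u , x , b) → ResiduesDivisible
    from (P∣E₁ , P∣E₂ , P∣E₃) =
      divides (P * (B * B - B)) (R₁₁≡ P B) ,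
      divides (B * (X - U)) (R₁ⱼ≡ P B X U) ,
      divides (B * (Y - V)) (R₁ⱼ≡ P B Y V) ,
      divisible (R₂₂≡ P B X U) (∣m⇒∣-m P∣E₁) ,
      divisible (R₂₃≡ P B X Y U V) (∣m⇒∣-m P∣E₂) ,
      divisible (R₃₃≡ P B Y V) (∣-lincomb (P * (B * V - Y)) (- 1ℤ) (reshift P (B * V - Y) E₃) ∣-refl P∣E₃)
      where
      reshift : ∀ P W E → P * (P * W) - E ≡ P * W * P + (- 1ℤ) * E
      reshift = solve-∀

  closed⇔admissible : ∀ {v y u x b} →
    ColumnSpanMulClosed (ColumnSpan.M P (P * + b) (+ x) (+ y) (+ u) (+ v)) ⇔ Admissible (v , y , u , x , b)
  closed⇔admissible {v} {y} {u} {x} {b} =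
    mk⇔ (Equivalence.to residues-divisible⇔admissible ∘ closed⇒residues-divisible)
        (residues-divisible⇒closed ∘ Equivalence.from residues-divisible⇔admissible)
    where open ColumnSpan P (P * + b) (+ x) (+ y) (+ u) (+ v) using (closed⇒residues-divisible; residues-divisible⇒closed)

  pos-^ : ∀ m n → + (m ^ n) ≡ (+ m) ^ℤ n
  pos-^ m zero    = refl
  pos-^ m (suc n) = trans (pos-* m (m ^ n)) (cong (+ m *_) (pos-^ m n))

  P³≡ : + (p ^ 3) ≡ P * P * P
  P³≡ = trans (pos-^ p 3) (cube P)
    where
    cube : ∀ Q → Q * (Q * (Q * 1ℤ)) ≡ Q * Q * Q
    cube = solve-∀

  M-diagonal : ∀ {A X Y U V} i → entry (ColumnSpan.M P A X Y U V) (inject₁ i) (inject₁ i) ≡ + (p ^ lookup α i)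
  M-diagonal 0F = sym P³≡
  M-diagonal 1F = sym (trans (pos-^ p 2) (cong (P *_) (*-identityʳ P)))
  M-diagonal 2F = sym (trans (pos-^ p 1) (*-identityʳ P))
  M-diagonal 3F = sym P³≡

  InRange : Params → Set
  InRange (v , y , u , x , b) = v < p × y < p Nat.* p × u < p × x < p Nat.* p × b < p

  matrix : Params → Matrix 5
  matrix (v , y , u , x , b) = ColumnSpan.M P (P * + b) (+ x) (+ y) (+ u) (+ v)

  p·p≡p^2 : p Nat.* p ≡ p ^ 2
  p·p≡p^2 = cong (p Nat.*_) (sym (ℕₚ.*-identityʳ p))

  matrix-irreducible : ∀ t → InRange t → Admissible t → IsIrredSubringMatrix p α (matrix t)
  matrix-irreducible t@(v , y , u , x , b) (v<p , y<p² , u<p , x<p² , b<p) admissible = record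
    { upper    = M-lower
    ; diag     = M-diagonal
    ; lastDiag = refl
    ; lastCol  = M-lastCol
    ; offDiag  = offDiagonal
    ; closed   = Equivalence.from closed⇔admissible admissible
    }
    where
    open ColumnSpan P (P * + b) (+ x) (+ y) (+ u) (+ v) using (M-lower; M-lastCol)
    <p² : ∀ {n} → n < p Nat.* p → n < p ^ 2
    <p² {n} = subst (n <_) p·p≡p^2
    <p¹ : ∀ {n} → n < p → n < p ^ 1
    <p¹ {n} = subst (n <_) (sym (ℕₚ.*-identityʳ p))
    offDiagonal : ∀ i j → i <ᶠ j →
      Σ ℕ λ a → a < p ^ (lookup α i ∸ 1) × entry (matrix t) (inject₁ i) (inject₁ j) ≡ + (p Nat.* a)
    offDiagonal 0F 1F _ = p Nat.* b , <p² (ℕₚ.*-monoʳ-< p b<p) ,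
                          sym (trans (pos-* p (p Nat.* b)) (cong (P *_) (pos-* p b)))
    offDiagonal 0F 2F _ = x , <p² x<p² , sym (pos-* p x)
    offDiagonal 0F 3F _ = y , <p² y<p² , sym (pos-* p y)
    offDiagonal 1F 2F _ = u , <p¹ u<p , sym (pos-* p u)
    offDiagonal 1F 3F _ = v , <p¹ v<p , sym (pos-* p v)
    offDiagonal 2F 3F _ = 0 , s≤s z≤n , cong +_ (sym (ℕₚ.*-zeroʳ p))
    offDiagonal 0F 0F ()
    offDiagonal 1F 0F ()
    offDiagonal 1F 1F (s≤s ())
    offDiagonal 2F 0F ()
    offDiagonal 2F 1F (s≤s ())
    offDiagonal 2F 2F (s≤s (s≤s ()))
    offDiagonal 3F 0F ()
    offDiagonal 3F 1F (s≤s ())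
    offDiagonal 3F 2F (s≤s (s≤s ()))
    offDiagonal 3F 3F (s≤s (s≤s (s≤s ())))

  irreducible⇒matrix : ∀ {A} → IsIrredSubringMatrix p α A → ∃[ t ] InRange t × Admissible t × A ≡ matrix t
  irreducible⇒matrix {A} irreducible = t , range , Equivalence.to closed⇔admissible closed-t , A≡matrix
    where
    open IsIrredSubringMatrix irreducible
    a₀₁ a₀₂ a₀₃ a₁₂ a₁₃ : ℕ
    a₀₁ = proj₁ (offDiag 0F 1F (s≤s z≤n))
    a₀₂ = proj₁ (offDiag 0F 2F (s≤s z≤n))
    a₀₃ = proj₁ (offDiag 0F 3F (s≤s z≤n))
    a₁₂ = proj₁ (offDiag 1F 2F (s≤s (s≤s z≤n)))
    a₁₃ = proj₁ (offDiag 1F 3F (s≤s (s≤s z≤n)))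
    open ColumnSpan P (+ a₀₁) (+ a₀₂) (+ a₀₃) (+ a₁₂) (+ a₁₃) using (M; M-lower; M-lastCol)
    read : ∀ i j (i<j : i <ᶠ j) → entry A (inject₁ i) (inject₁ j) ≡ P * + proj₁ (offDiag i j i<j)
    read i j i<j = trans (proj₂ (proj₂ (offDiag i j i<j))) (pos-* p _)
    above : ∀ i j → i <ᶠ j → entry A (inject₁ i) (inject₁ j) ≡ entry M (inject₁ i) (inject₁ j)
    above 0F 1F (s≤s z≤n) = read 0F 1F (s≤s z≤n)
    above 0F 2F (s≤s z≤n) = read 0F 2F (s≤s z≤n)
    above 0F 3F (s≤s z≤n) = read 0F 3F (s≤s z≤n)
    above 1F 2F (s≤s (s≤s z≤n)) = read 1F 2F (s≤s (s≤s z≤n))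
    above 1F 3F (s≤s (s≤s z≤n)) = read 1F 3F (s≤s (s≤s z≤n))
    above 2F 3F i<j with offDiag 2F 3F i<j
    ... | a , a<1 , eq = trans eq (cong +_ (trans (cong (p Nat.*_) (ℕₚ.n<1⇒n≡0 a<1)) (ℕₚ.*-zeroʳ p)))
    above 0F 0F ()
    above 1F 0F ()
    above 1F 1F (s≤s ())
    above 2F 0F ()
    above 2F 1F (s≤s ())
    above 2F 2F (s≤s (s≤s ()))
    above 3F 0F ()
    above 3F 1F (s≤s ())
    above 3F 2F (s≤s (s≤s ()))
    above 3F 3F (s≤s (s≤s (s≤s ())))
    A≡M : A ≡ M
    A≡M = entries-by-region⇒≡ (λ i j j<i → trans (upper i j j<i) (sym (M-lower i j j<i)))
                               (λ i → trans (diag i) (sym (M-diagonal i)))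
                               (λ i → trans (lastCol i) (sym (M-lastCol i)))
                               above
    p∣a₀₁ : p ℕ∣.∣ a₀₁
    p∣a₀₁ = ∣⇒∣ᵤ (closed⇒P∣A (subst ColumnSpanMulClosed A≡M closed))
    b : ℕ
    b = ℕ∣.quotient p∣a₀₁
    a₀₁≡pb : a₀₁ ≡ p Nat.* b
    a₀₁≡pb = ℕ∣.m∣n⇒n≡m*quotient p∣a₀₁
    t : Params
    t = a₁₃ , a₀₃ , a₁₂ , a₀₂ , b
    A≡matrix : A ≡ matrix t
    A≡matrix = trans A≡M (cong (λ a → ColumnSpan.M P a (+ a₀₂) (+ a₀₃) (+ a₁₂) (+ a₁₃))
                               (trans (cong +_ a₀₁≡pb) (pos-* p b)))
    closed-t : ColumnSpanMulClosed (matrix t)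
    closed-t = subst ColumnSpanMulClosed A≡matrix closed
    <p : ∀ {n} → n < p ^ 1 → n < p
    <p {n} = subst (n <_) (ℕₚ.*-identityʳ p)
    <p·p : ∀ {n} → n < p ^ 2 → n < p Nat.* p
    <p·p {n} = subst (n <_) (sym p·p≡p^2)
    range : InRange t
    range = <p (proj₁ (proj₂ (offDiag 1F 3F (s≤s (s≤s z≤n))))) ,
            <p·p (proj₁ (proj₂ (offDiag 0F 3F (s≤s z≤n)))) ,
            <p (proj₁ (proj₂ (offDiag 1F 2F (s≤s (s≤s z≤n))))) ,
            <p·p (proj₁ (proj₂ (offDiag 0F 2F (s≤s z≤n)))) ,
            ℕₚ.*-cancelˡ-< p b p (subst (_< p Nat.* p) a₀₁≡pb (<p·p (proj₁ (proj₂ (offDiag 0F 1F (s≤s z≤n))))))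

  matrix-injective : ∀ {t t′} → matrix t ≡ matrix t′ → t ≡ t′
  matrix-injective {t@(v , y , u , x , b)} {t′@(v′ , y′ , u′ , x′ , b′)} eq =
    cong₂ _,_ (P-cancel (entries 1F 3F)) (cong₂ _,_ (P-cancel (entries 0F 3F)) (cong₂ _,_ (P-cancel (entries 1F 2F))
      (cong₂ _,_ (P-cancel (entries 0F 2F)) (P-cancel (*-cancelˡ-≡ P _ _ (entries 0F 1F))))))
    where
    entries : ∀ i j → entry (matrix t) i j ≡ entry (matrix t′) i j
    entries i j = cong (λ M → entry M i j) eq
    P-cancel : ∀ {m n} → P * + m ≡ P * + n → m ≡ n
    P-cancel {m} {n} = +-injective ∘ *-cancelˡ-≡ P (+ m) (+ n)

module Counting {p : ℕ} (p-prime : Prime p) where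

  open Nat using (_+_; _*_; _<_; z≤n; s≤s)
  open import Data.Nat using (_≟_; _<?_)
  open import Data.Nat.Tactic.RingSolver using (solve-∀)
  open import Relation.Nullary.Decidable using (_×-dec_; _⊎-dec_)
  open FiniteSums
  open Congruence p-prime using (1<p)
  open Admissibility p-prime

  0<p : 0 < p
  0<p = ℕₚ.<-trans (s≤s z≤n) 1<p

  ⟦_⟧ : Params → ℕ
  ⟦ t ⟧ = 𝟙 (admissible? t)

  quadratic-count : ∀ {u} → u < p → Σ< p (λ x → Σ< p (λ b → 𝟙 (quadratic? u x b))) ≡ p + p * 𝟙 (u <? 2)
  quadratic-count {u} u<p with u <? 2
  ... | yes u<2 = begin
    Σ< p (λ x → Σ< p (λ b → 𝟙 (quadratic? u x b)))
      ≡⟨ Σ-cong p (λ x x<p → Σ-cong p (λ b _ → 𝟙-cong (quadratic-u<2⇔ {u} {x} {b} u<2 x<p) (quadratic? u x b) (x <? 2))) ⟩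
    Σ< p (λ x → Σ< p (λ _ → 𝟙 (x <? 2)))  ≡⟨ Σ-cong p (λ x _ → Σ-const p (𝟙 (x <? 2))) ⟩
    Σ< p (λ x → p * 𝟙 (x <? 2))            ≡⟨ Σ-*ˡ p p (λ x → 𝟙 (x <? 2)) ⟩
    p * Σ< p (λ x → 𝟙 (x <? 2))            ≡⟨ cong (p *_) (Σ-𝟙-< p 1<p) ⟩
    p * 2                                  ≡⟨ ℕₚ.*-suc p 1 ⟩
    p + p * 1                              ∎
    where open ≡-Reasoning
  ... | no u≮2 = trans (Σ-cong p (λ x _ → unique x)) (trans (Σ-const p 1) (ℕₚ.*-suc p 0))
    where
    unique : ∀ x → Σ< p (λ b → 𝟙 (quadratic? u x b)) ≡ 1
    unique x = count (quadratic-unique {u} {x} u<p (ℕₚ.≮⇒≥ u≮2))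
      where
      count : ∃[ b₀ ] b₀ < p × (∀ {b} → b < p → Quadratic u x b ⇔ b ≡ b₀) → Σ< p (λ b → 𝟙 (quadratic? u x b)) ≡ 1
      count (b₀ , b₀<p , Q⇔b≡b₀) =
        trans (Σ-cong p (λ b b<p → 𝟙-cong (Q⇔b≡b₀ {b} b<p) (quadratic? u x b) (b ≟ b₀))) (Σ-𝟙-≡ p b₀<p)

  uxbCount : ℕ → ℕ → ℕ
  uxbCount v y = Σ< p (λ u → Σ< p (λ x → Σ< p (λ b → ⟦ v , y , u , x , b ⟧)))

  yuxbCount : ℕ → ℕ
  yuxbCount v = Σ< p (uxbCount v)

  yuxbCount-0 : yuxbCount 0 ≡ p * p + p * 2
  yuxbCount-0 = begin
    yuxbCount 0
      ≡⟨ Σ-point p 0 0<p (λ y y<p y≢0 → Σ-zero p (λ u _ → Σ-zero p (λ x _ → Σ-zero p (λ b _ →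
           𝟙-no (y≢0 ∘ proj₁ ∘ Equivalence.to (admissible-v≡0⇔ {y} {u} {x} {b} y<p)) (admissible? (0 , y , u , x , b)))))) ⟩
    uxbCount 0 0
      ≡⟨ Σ-cong p (λ u _ → Σ-cong p (λ x _ → Σ-cong p (λ b _ →
           𝟙-cong (quadratic⇔ {u} {x} {b}) (admissible? (0 , 0 , u , x , b)) (quadratic? u x b)))) ⟩
    Σ< p (λ u → Σ< p (λ x → Σ< p (λ b → 𝟙 (quadratic? u x b))))
      ≡⟨ Σ-cong p (λ u u<p → quadratic-count u<p) ⟩
    Σ< p (λ u → p + p * 𝟙 (u <? 2))
      ≡⟨ Σ-+ p (λ _ → p) (λ u → p * 𝟙 (u <? 2)) ⟩
    Σ< p (λ _ → p) + Σ< p (λ u → p * 𝟙 (u <? 2))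
      ≡⟨ cong₂ _+_ (Σ-const p p) (trans (Σ-*ˡ p p (λ u → 𝟙 (u <? 2))) (cong (p *_) (Σ-𝟙-< p 1<p))) ⟩
    p * p + p * 2 ∎
    where
    open ≡-Reasoning
    quadratic⇔ : ∀ {u x b} → Admissible (0 , 0 , u , x , b) ⇔ Quadratic u x b
    quadratic⇔ {u} {x} {b} = mk⇔ (proj₂ ∘ Equivalence.to (admissible-v≡0⇔ {0} {u} {x} {b} 0<p))
                                 (λ q → Equivalence.from (admissible-v≡0⇔ {0} {u} {x} {b} 0<p) (refl , q))

  uxbCount-y≡0 : ∀ {v} → v < p → v ≢ 0 → uxbCount v 0 ≡ p * 2
  uxbCount-y≡0 {v} v<p v≢0 = begin
    uxbCount v 0
      ≡⟨ Σ-cong p (λ u _ → Σ-cong p (λ x x<p → Σ-𝟙-unique p (λ b → admissible? (v , 0 , u , x , b)) (x <? 2) 0<p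
           (λ b b<p → admissible-y≡0⇔ {v} {u} {x} {b} v<p v≢0 x<p b<p))) ⟩
    Σ< p (λ u → Σ< p (λ x → 𝟙 (x <? 2)))  ≡⟨ Σ-cong p (λ u _ → Σ-𝟙-< p 1<p) ⟩
    Σ< p (λ u → 2)                       ≡⟨ Σ-const p 2 ⟩
    p * 2                                ∎
    where open ≡-Reasoning

  uxbCount-y≢0 : ∀ {v y} → v < p → v ≢ 0 → y < p → y ≢ 0 → uxbCount v y ≡ Σ< p (λ u → 𝟙 ((u ≟ 0) ⊎-dec (y ≟ v)))
  uxbCount-y≢0 {v} {y} v<p v≢0 y<p y≢0 = Σ-cong p (λ u u<p → count (admissible-v,y≢0⇔ {v} {y} {u} v<p v≢0 y<p y≢0 u<p))
    where
    count : ∀ {u} → ∃[ x₀ ] ∃[ b₀ ] x₀ < p × b₀ < p × (∀ {x b} → x < p → b < p →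
                      Admissible (v , y , u , x , b) ⇔ (b ≡ b₀ × x ≡ x₀ × (u ≡ 0 ⊎ y ≡ v))) →
            Σ< p (λ x → Σ< p (λ b → ⟦ v , y , u , x , b ⟧)) ≡ 𝟙 ((u ≟ 0) ⊎-dec (y ≟ v))
    count {u} (x₀ , b₀ , x₀<p , b₀<p , admissible⇔) =
      trans (Σ-cong p (λ x x<p → Σ-𝟙-unique p (λ b → admissible? (v , y , u , x , b)) ((x ≟ x₀) ×-dec ((u ≟ 0) ⊎-dec (y ≟ v)))
                                            b₀<p (λ b b<p → admissible⇔ {x} {b} x<p b<p)))
            (Σ-𝟙-unique p (λ x → (x ≟ x₀) ×-dec ((u ≟ 0) ⊎-dec (y ≟ v))) ((u ≟ 0) ⊎-dec (y ≟ v)) x₀<p (λ _ _ → mk⇔ id id))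

  -- uxbCount v y is 2p at y = 0, p at y = v and 1 elsewhere.
  uxbCount-spikes : ∀ {v y} → v < p → v ≢ 0 → y < p →
                    uxbCount v y + 1 * 𝟙 (y ≟ 0) + 1 * 𝟙 (y ≟ v) ≡ 1 + p * 2 * 𝟙 (y ≟ 0) + p * 𝟙 (y ≟ v)
  uxbCount-spikes {v} {y} v<p v≢0 y<p = cases (y ≟ 0) (y ≟ v)
    where
    at-0 : ∀ p → p * 2 + 1 + 0 ≡ 1 + p * 2 * 1 + p * 0
    at-0 = solve-∀
    at-v : ∀ p → p * 1 + 0 + 1 ≡ 1 + p * 2 * 0 + p * 1
    at-v = solve-∀
    elsewhere : ∀ p → 1 + 0 + 0 ≡ 1 + p * 2 * 0 + p * 0
    elsewhere = solve-∀
    cases : (y≟0 : Dec (y ≡ 0)) (y≟v : Dec (y ≡ v)) →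
            uxbCount v y + 1 * 𝟙 y≟0 + 1 * 𝟙 y≟v ≡ 1 + p * 2 * 𝟙 y≟0 + p * 𝟙 y≟v
    cases (yes y≡0) (yes y≡v) = contradiction (trans (sym y≡v) y≡0) v≢0
    cases (yes y≡0) (no _)    = trans (cong (λ y → uxbCount v y + 1 + 0) y≡0)
                                      (trans (cong (λ n → n + 1 + 0) (uxbCount-y≡0 v<p v≢0)) (at-0 p))
    cases (no y≢0)  (yes y≡v) = trans (cong (λ n → n + 0 + 1) every-u) (at-v p)
      where
      every-u : uxbCount v y ≡ p * 1
      every-u = trans (uxbCount-y≢0 v<p v≢0 y<p y≢0)
                      (trans (Σ-cong p (λ u _ → 𝟙-yes (inj₂ y≡v) ((u ≟ 0) ⊎-dec (y ≟ v)))) (Σ-const p 1))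
    cases (no y≢0)  (no y≢v)  = trans (cong (λ n → n + 0 + 0) only-u≡0) (elsewhere p)
      where
      only-u≡0 : uxbCount v y ≡ 1
      only-u≡0 = trans (uxbCount-y≢0 v<p v≢0 y<p y≢0)
        (trans (Σ-cong p (λ u _ → 𝟙-cong (mk⇔ [ id , (λ y≡v → contradiction y≡v y≢v) ]′ inj₁) ((u ≟ 0) ⊎-dec (y ≟ v)) (u ≟ 0)))
               (Σ-𝟙-≡ p 0<p))

  yuxbCount-v≢0 : ∀ {v} → v < p → v ≢ 0 → yuxbCount v + 2 ≡ p * 4
  yuxbCount-v≢0 {v} v<p v≢0 = begin
    yuxbCount v + 2                                                        ≡⟨ ℕₚ.+-assoc (yuxbCount v) 1 1 ⟨
    yuxbCount v + 1 + 1                                                    ≡⟨ cong (_+ 1) (Σ-spike p (uxbCount v) 1 0<p) ⟨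
    Σ< p (λ y → uxbCount v y + 1 * 𝟙 (y ≟ 0)) + 1                         ≡⟨ Σ-spike p _ 1 v<p ⟨
    Σ< p (λ y → uxbCount v y + 1 * 𝟙 (y ≟ 0) + 1 * 𝟙 (y ≟ v))             ≡⟨ Σ-cong p (λ y y<p → uxbCount-spikes v<p v≢0 y<p) ⟩
    Σ< p (λ y → 1 + p * 2 * 𝟙 (y ≟ 0) + p * 𝟙 (y ≟ v))                    ≡⟨ Σ-spike p _ p v<p ⟩
    Σ< p (λ y → 1 + p * 2 * 𝟙 (y ≟ 0)) + p                                ≡⟨ cong (_+ p) (Σ-spike p (λ _ → 1) (p * 2) 0<p) ⟩
    Σ< p (λ _ → 1) + p * 2 + p                                            ≡⟨ cong (λ n → n + p * 2 + p) (Σ-const p 1) ⟩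
    p * 1 + p * 2 + p                                                     ≡⟨ four p ⟩
    p * 4                                                                  ∎
    where
    open ≡-Reasoning
    four : ∀ p → p * 1 + p * 2 + p ≡ p * 4
    four = solve-∀

  residueCount : ℕ
  residueCount = Σ< p yuxbCount

  residueCount-value : residueCount + p * 4 ≡ p * p * 5 + 2
  residueCount-value = ℕₚ.+-cancelʳ-≡ (p * 2) _ _ (begin
    residueCount + p * 4 + p * 2                     ≡⟨ reorder residueCount p ⟩
    residueCount + p * 2 + p * 4                     ≡⟨ cong (_+ p * 4) (trans (Σ-+ p yuxbCount (λ _ → 2))
                                                                               (cong (residueCount +_) (Σ-const p 2))) ⟨
    Σ< p (λ v → yuxbCount v + 2) + p * 4             ≡⟨ Σ-except p (p * 4) 0<p (λ v v<p v≢0 → yuxbCount-v≢0 v<p v≢0) ⟩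
    p * (p * 4) + (yuxbCount 0 + 2)                  ≡⟨ cong (λ n → p * (p * 4) + (n + 2)) yuxbCount-0 ⟩
    p * (p * 4) + (p * p + p * 2 + 2)                ≡⟨ total p ⟩
    p * p * 5 + 2 + p * 2                            ∎)
    where
    open ≡-Reasoning
    reorder : ∀ n p → n + p * 4 + p * 2 ≡ n + p * 2 + p * 4
    reorder = solve-∀
    total : ∀ p → p * (p * 4) + (p * p + p * 2 + 2) ≡ p * p * 5 + 2 + p * 2
    total = solve-∀

  rangeCount : ℕ
  rangeCount = Σ< p λ v → Σ< (p * p) λ y → Σ< p λ u → Σ< (p * p) λ x → Σ< p λ b → ⟦ v , y , u , x , b ⟧

  rangeCount≡ : rangeCount ≡ p * (p * residueCount)
  rangeCount≡ = begin
    rangeCount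
      ≡⟨ Σ-cong p (λ v _ → Σ-cong (p * p) (λ y _ → Σ-cong p (λ u _ → Σ-periodic p p (λ k x _ → Σ-cong p (λ b _ →
           𝟙-cong (admissible-periodic {v} {y} {u} {x} {b} 0 k)
                  (admissible? (v , y , u , k * p + x , b)) (admissible? (v , y , u , x , b))))))) ⟩
    Σ< p (λ v → Σ< (p * p) λ y → Σ< p λ u → p * Σ< p λ x → Σ< p λ b → ⟦ v , y , u , x , b ⟧)
      ≡⟨ Σ-cong p (λ v _ → Σ-cong (p * p) (λ y _ → Σ-*ˡ p p _)) ⟩
    Σ< p (λ v → Σ< (p * p) λ y → p * uxbCount v y)
      ≡⟨ Σ-cong p (λ v _ → trans (Σ-*ˡ (p * p) p (uxbCount v)) (cong (p *_) (Σ-periodic p p (λ k y _ →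
           Σ-cong p (λ u _ → Σ-cong p (λ x _ → Σ-cong p (λ b _ →
             𝟙-cong (admissible-periodic {v} {y} {u} {x} {b} k 0)
                    (admissible? (v , k * p + y , u , x , b)) (admissible? (v , y , u , x , b))))))))) ⟩
    Σ< p (λ v → p * (p * yuxbCount v))
      ≡⟨ trans (Σ-*ˡ p p (λ v → p * yuxbCount v)) (cong (p *_) (Σ-*ˡ p p yuxbCount)) ⟩
    p * (p * residueCount) ∎
    where open ≡-Reasoning

open import Data.Nat.Base using (_+_; _*_; _^_; _∸_)
open import Data.List.Base using (List; map; filter; length; downFrom; cartesianProduct)
open import Data.List.Properties using (length-map)
open import Data.List.Membership.Propositional using (_∈_)
open import Data.List.Membership.Propositional.Properties
  using (∈-filter⁺; ∈-filter⁻; ∈-cartesianProduct⁺; ∈-cartesianProduct⁻; ∈-downFrom⁺; ∈-downFrom⁻; ∈-map⁺; ∈-map⁻)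
open import Data.List.Relation.Unary.Unique.Propositional using (Unique)
import Data.List.Relation.Unary.Unique.Propositional.Properties as Unique

module Enumeration {p : ℕ} (p-prime : Prime p) where

  open Admissibility p-prime using (Params; Admissible; admissible?)
  open Classification p-prime using (InRange)
  open Counting p-prime using (rangeCount)
  open FiniteSums using (Σ-cong; length-filter-cartesianProduct; length-filter-downFrom)

  grid : List Params
  grid = cartesianProduct (downFrom p) (cartesianProduct (downFrom (p * p))
           (cartesianProduct (downFrom p) (cartesianProduct (downFrom (p * p)) (downFrom p))))

  admissibleGrid : List Params
  admissibleGrid = filter admissible? grid

  admissibleGrid-unique : Unique admissibleGrid
  admissibleGrid-unique = Unique.filter⁺ admissible?
    (Unique.cartesianProduct⁺ (Unique.downFrom⁺ p) (Unique.cartesianProduct⁺ (Unique.downFrom⁺ (p * p))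
      (Unique.cartesianProduct⁺ (Unique.downFrom⁺ p) (Unique.cartesianProduct⁺ (Unique.downFrom⁺ (p * p)) (Unique.downFrom⁺ p)))))

  ∈-admissibleGrid⁺ : ∀ t → InRange t → Admissible t → t ∈ admissibleGrid
  ∈-admissibleGrid⁺ (v , y , u , x , b) (v<p , y<p² , u<p , x<p² , b<p) =
    ∈-filter⁺ admissible? (∈-cartesianProduct⁺ (∈-downFrom⁺ v<p) (∈-cartesianProduct⁺ (∈-downFrom⁺ y<p²)
      (∈-cartesianProduct⁺ (∈-downFrom⁺ u<p) (∈-cartesianProduct⁺ (∈-downFrom⁺ x<p²) (∈-downFrom⁺ b<p)))))

  ∈-admissibleGrid⁻ : ∀ t → t ∈ admissibleGrid → InRange t × Admissible t
  ∈-admissibleGrid⁻ t@(v , y , u , x , b) t∈ with ∈-filter⁻ admissible? t∈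
  ... | t∈grid , admissible with ∈-cartesianProduct⁻ (downFrom p) _ t∈grid
  ... | v∈ , rest₁ with ∈-cartesianProduct⁻ (downFrom (p * p)) _ rest₁
  ... | y∈ , rest₂ with ∈-cartesianProduct⁻ (downFrom p) _ rest₂
  ... | u∈ , rest₃ with ∈-cartesianProduct⁻ (downFrom (p * p)) _ rest₃
  ... | x∈ , b∈ = (∈-downFrom⁻ v∈ , ∈-downFrom⁻ y∈ , ∈-downFrom⁻ u∈ , ∈-downFrom⁻ x∈ , ∈-downFrom⁻ b∈) , admissible

  length-admissibleGrid : length admissibleGrid ≡ rangeCount
  length-admissibleGrid =
    trans (length-filter-cartesianProduct admissible? p _) (Σ-cong p (λ v _ →
    trans (length-filter-cartesianProduct _ (p * p) _) (Σ-cong (p * p) (λ y _ →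
    trans (length-filter-cartesianProduct _ p _) (Σ-cong p (λ u _ →
    trans (length-filter-cartesianProduct _ (p * p) _) (Σ-cong (p * p) (λ x _ →
    length-filter-downFrom _ p))))))))

count-formula : ∀ p n → n + p * 4 ≡ p * p * 5 + 2 → p * (p * n) ≡ 5 * p ^ 4 + 2 * p ^ 2 ∸ 4 * p ^ 3
count-formula p n n+4p≡5p²+2 = begin
  p * (p * n)                                  ≡⟨ ℕₚ.m+n∸n≡m (p * (p * n)) (4 * p ^ 3) ⟨
  p * (p * n) + 4 * p ^ 3 ∸ 4 * p ^ 3          ≡⟨ cong (_∸ 4 * p ^ 3) (factor p n) ⟩
  p * (p * (n + p * 4)) ∸ 4 * p ^ 3            ≡⟨ cong (λ m → p * (p * m) ∸ 4 * p ^ 3) n+4p≡5p²+2 ⟩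
  p * (p * (p * p * 5 + 2)) ∸ 4 * p ^ 3        ≡⟨ cong (_∸ 4 * p ^ 3) (expand p) ⟩
  5 * p ^ 4 + 2 * p ^ 2 ∸ 4 * p ^ 3            ∎
  where
  open ≡-Reasoning
  open import Data.Nat.Tactic.RingSolver using (solve-∀)
  factor : ∀ p n → p * (p * n) + 4 * (p * (p * (p * 1))) ≡ p * (p * (n + p * 4))
  factor = solve-∀
  expand : ∀ p → p * (p * (p * p * 5 + 2)) ≡ 5 * (p * (p * (p * (p * 1)))) + 2 * (p * (p * 1))
  expand = solve-∀

lemma5p2 : ∀ (p : ℕ) → Prime p →
    g≡ p (3 ∷ 2 ∷ 1 ∷ 3 ∷ []) (5 * p ^ 4 + 2 * p ^ 2 ∸ 4 * p ^ 3)
lemma5p2 p p-prime =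
  map matrix admissibleGrid ,
  Unique.map⁺ matrix-injective admissibleGrid-unique ,
  (λ A → mk⇔ (irreducible A) (listed A)) ,
  trans (length-map matrix admissibleGrid)
        (trans length-admissibleGrid (trans rangeCount≡ (count-formula p residueCount residueCount-value)))
  where
  open Classification p-prime
  open Counting p-prime using (rangeCount≡; residueCount; residueCount-value)
  open Enumeration p-prime
  open Admissibility p-prime using (Admissible)
  irreducible : ∀ A → A ∈ map matrix admissibleGrid → IsIrredSubringMatrix p α A
  irreducible A A∈ = from-grid (∈-map⁻ matrix A∈)
    where
    from-grid : ∃[ t ] t ∈ admissibleGrid × A ≡ matrix t → IsIrredSubringMatrix p α A
    from-grid (t , t∈ , A≡) = subst (IsIrredSubringMatrix p α) (sym A≡)
      (matrix-irreducible t (proj₁ (∈-admissibleGrid⁻ t t∈)) (proj₂ (∈-admissibleGrid⁻ t t∈)))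
  listed : ∀ A → IsIrredSubringMatrix p α A → A ∈ map matrix admissibleGrid
  listed A irr = to-grid (irreducible⇒matrix irr)
    where
    to-grid : ∃[ t ] InRange t × Admissible t × A ≡ matrix t → A ∈ map matrix admissibleGrid
    to-grid (t , range , admissible , A≡) = subst (_∈ map matrix admissibleGrid) (sym A≡)
      (∈-map⁺ matrix (∈-admissibleGrid⁺ t range admissible))
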